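{- Let $p$ be a prime and let $k\ge1$ and $r>1$ be integers. Then (i) $|Z_k(r,t)|=p^{2k}\,|Z_k(r-1,t)|$ for every integer $t$ with $1\le t<r-1$; (ii) $|Z_k(r,r-1)|=p^{2k-1}(p-1)\,|Z_k(r-1)|$.
   Context: For a positive integer $n$, $\mathscr{E}_n$ is the directed graph whose vertices are the pairs $(a,b)$ with $a,b\in\{0,\dots,n-1\}$ and $\gcd(a,b,n)=1$, written $a/b$ (integer representatives modulo $n$ may also be used), with a directed edge $a/b\to c/d$ iff $ad-bc\equiv1\pmod n$. A path of length $m$ is a sequence $\langle v_0,\dots,v_m\rangle$ of vertices with edges $v_{i-1}\to v_i$. Let $\varepsilon=1$ if $k$ is even and $\varepsilon=-1$ if $k$ is odd. $\Omega_{2k}(p)$ is the set of paths $\langle v_0,\dots,v_{2k}\rangle$ of length $2k$ in $\mathscr{E}_p$ with $v_{2i}=(-1)^i/0$ for $i=0,1,\dots,k$ (so they have the form $1/0\to\lambda_1/1\to-1/0\to\lambda_2/(-1)\to\dots\to\varepsilon/0$). For $r\ge1$, a lift to $\mathscr{E}_{p^r}$ of a path $\langle v_0,\dots,v_{2k}\rangle$ in $\mathscr{E}_p$ is a path $\langle w_0,\dots,w_{2k}\rangle$ in $\mathscr{E}_{p^r}$ with $w_i$ reducing modulo $p$ to $v_i$ for all $i$. $Z_k(r)$ is the set of lifts to $\mathscr{E}_{p^r}$ of paths in $\Omega_{2k}(p)$ with initial vertex $1/0$ and final vertex $\varepsilon/0$. For $1\le t<r$, $Z_k(r,t)$ is the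 set of lifts to $\mathscr{E}_{p^r}$ of paths in $\Omega_{2k}(p)$ with initial vertex $1/0$ and final vertex of the form $(\varepsilon+a)/b$ with $a,b\in\mathbb{Z}/p^r\mathbb{Z}$, $a,b\equiv0\pmod p$, $\nu_p(b)=t$ and $\nu_p(a)\ge\nu_p(b)$; here $\nu_p$ of an element of $\mathbb{Z}/p^r\mathbb{Z}$ is the $p$-adic valuation of its representative in $\{0,\dots,p^r-1\}$, with $\nu_p(0)=\infty$. -}

module Defs where

open import Data.Nat as ℕ using (ℕ; zero; suc; _∸_; _%_; _/_)
open import Data.Nat.Divisibility using (_∣_; _∣?_)
open import Data.Nat.GCD using (gcd)
open import Data.Integer as ℤ using (ℤ; +_; ∣_∣)
open import Data.Fin using (Fin; toℕ; inject₁; fromℕ; suc)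
open import Data.Fin.Properties using (all?)
open import Data.Vec using (Vec; []; _∷_; lookup)
open import Data.List using (List; []; _∷_; length; filter; map; cartesianProduct; allFin; concatMap)
open import Data.List.Relation.Unary.Any using (Any; any?)
open import Data.Product using (_×_; _,_; proj₁; proj₂)
open import Relation.Nullary using (¬_; Dec; yes; no; ¬?)
open import Relation.Nullary.Decidable using (_×-dec_; _→-dec_)
open import Relation.Unary using (Pred; Decidable)
open import Relation.Binary.PropositionalEquality using (_≡_)
import Data.Nat.Properties as ℕP

_≡_[mod_] : ℤ → ℤ → ℕ → Set
x ≡ y [mod n ] = n ∣ ∣ x ℤ.- y ∣

_≡?_[mod_] : (x y : ℤ) (n : ℕ) → Dec (x ≡ y [mod n ])
x ≡? y [mod n ] = n ∣? ∣ x ℤ.- y ∣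

-- The graph 𝓔_n.  A raw pair (a , b) with a b ∈ {0,…,n-1}, written a/b.

Pair : ℕ → Set
Pair n = Fin n × Fin n

num den : ∀ {n} → Pair n → ℤ
num (a , b) = + toℕ a
den (a , b) = + toℕ b

IsVertex : (n : ℕ) → Pair n → Set
IsVertex n (a , b) = gcd (gcd (toℕ a) (toℕ b)) n ≡ 1

isVertex? : (n : ℕ) → Decidable (IsVertex n)
isVertex? n (a , b) = gcd (gcd (toℕ a) (toℕ b)) n ℕP.≟ 1

Edge : (n : ℕ) → Pair n → Pair n → Set
Edge n v w = (num v ℤ.* den w ℤ.- den v ℤ.* num w) ≡ ℤ.1ℤ [mod n ]

edge? : (n : ℕ) (v w : Pair n) → Dec (Edge n v w)
edge? n v w = (num v ℤ.* den w ℤ.- den v ℤ.* num w) ≡? ℤ.1ℤ [mod n ]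

VEq : (n : ℕ) → Pair n → ℤ → ℤ → Set
VEq n v x y = (num v ≡ x [mod n ]) × (den v ≡ y [mod n ])

vEq? : (n : ℕ) (v : Pair n) (x y : ℤ) → Dec (VEq n v x y)
vEq? n v x y = (num v ≡? x [mod n ]) ×-dec (den v ≡? y [mod n ])

IsPath : (n m : ℕ) → Vec (Pair n) (suc m) → Set
IsPath n m v = (∀ (i : Fin (suc m)) → IsVertex n (lookup v i))
             × (∀ (i : Fin m) → Edge n (lookup v (inject₁ i)) (lookup v (suc i)))

isPath? : (n m : ℕ) → Decidable (IsPath n m)
isPath? n m v = all? (λ i → isVertex? n (lookup v i))
         ×-dec all? (λ i → edge? n (lookup v (inject₁ i)) (lookup v (suc i)))

-1ℤ : ℤ
-1ℤ = ℤ.-[1+ 0 ]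

ε : ℕ → ℤ
ε k = -1ℤ ℤ.^ k

InΩ : (p k : ℕ) → Vec (Pair p) (suc (2 ℕ.* k)) → Set
InΩ p k v = IsPath p (2 ℕ.* k) v
          × (∀ (j : Fin (suc (2 ℕ.* k))) → toℕ j % 2 ≡ 0 →
               VEq p (lookup v j) (-1ℤ ℤ.^ (toℕ j / 2)) (+ 0))

inΩ? : (p k : ℕ) → Decidable (InΩ p k)
inΩ? p k v = isPath? p (2 ℕ.* k) v
       ×-dec all? (λ j → (toℕ j % 2 ℕP.≟ 0) →-dec vEq? p (lookup v j) (-1ℤ ℤ.^ (toℕ j / 2)) (+ 0))

Reduces : (p r m : ℕ) → Vec (Pair (p ℕ.^ r)) m → Vec (Pair p) m → Set
Reduces p r m w v = ∀ (i : Fin m) → VEq p (lookup v i) (num (lookup w i)) (den (lookup w i))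

reduces? : (p r m : ℕ) (w : Vec (Pair (p ℕ.^ r)) m) (v : Vec (Pair p) m) → Dec (Reduces p r m w v)
reduces? p r m w v = all? (λ i → vEq? p (lookup v i) (num (lookup w i)) (den (lookup w i)))

allVecs : ∀ {A : Set} (m : ℕ) → List A → List (Vec A m)
allVecs zero    xs = [] ∷ []
allVecs (suc m) xs = concatMap (λ x → map (x ∷_) (allVecs m xs)) xs

allPairs : (n : ℕ) → List (Pair n)
allPairs n = cartesianProduct (allFin n) (allFin n)

Seqs : (n k : ℕ) → List (Vec (Pair n) (suc (2 ℕ.* k)))
Seqs n k = allVecs (suc (2 ℕ.* k)) (allPairs n)

LiftOfΩ : (p k r : ℕ) → Vec (Pair (p ℕ.^ r)) (suc (2 ℕ.* k)) → Set
LiftOfΩ p k r w = IsPath (p ℕ.^ r) (2 ℕ.* k) w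
                × Any (λ v → InΩ p k v × Reduces p r (suc (2 ℕ.* k)) w v) (Seqs p k)

liftOfΩ? : (p k r : ℕ) → Decidable (LiftOfΩ p k r)
liftOfΩ? p k r w = isPath? (p ℕ.^ r) (2 ℕ.* k) w
             ×-dec any? (λ v → inΩ? p k v ×-dec reduces? p r (suc (2 ℕ.* k)) w v) (Seqs p k)

first last : ∀ {A : Set} {k : ℕ} → Vec A (suc (2 ℕ.* k)) → A
first w = lookup w Data.Fin.zero
last {k = k} w = lookup w (fromℕ (2 ℕ.* k))

InZ : (p k r : ℕ) → Vec (Pair (p ℕ.^ r)) (suc (2 ℕ.* k)) → Set
InZ p k r w = LiftOfΩ p k r w
            × VEq (p ℕ.^ r) (first {k = k} w) ℤ.1ℤ (+ 0)
            × VEq (p ℕ.^ r) (last {k = k} w) (ε k) (+ 0)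

inZ? : (p k r : ℕ) → Decidable (InZ p k r)
inZ? p k r w = liftOfΩ? p k r w
  ×-dec vEq? (p ℕ.^ r) (first {k = k} w) ℤ.1ℤ (+ 0)
  ×-dec vEq? (p ℕ.^ r) (last {k = k} w) (ε k) (+ 0)

-- Z_k(r,t): lifts with initial vertex 1/0 and final vertex (ε + a)/b where
-- a ≡ b ≡ 0 (mod p), ν_p(b) = t and ν_p(a) ≥ ν_p(b) = t.
-- Here b is the representative in {0,…,p^r-1} of the denominator, and
-- a = numerator - ε; since t < r, "ν_p(a) ≥ t" for a ∈ ℤ/p^rℤ is p^t ∣ (numerator - ε).
InZt : (p k r t : ℕ) → Vec (Pair (p ℕ.^ r)) (suc (2 ℕ.* k)) → Set
InZt p k r t w = LiftOfΩ p k r w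
               × VEq (p ℕ.^ r) (first {k = k} w) ℤ.1ℤ (+ 0)
               × (num (last {k = k} w) ≡ ε k [mod p ])
               × (den (last {k = k} w) ≡ + 0 [mod p ])
               × ((p ℕ.^ t) ∣ toℕ (proj₂ (last {k = k} w)))
               × (¬ (p ℕ.^ suc t) ∣ toℕ (proj₂ (last {k = k} w)))
               × (num (last {k = k} w) ≡ ε k [mod p ℕ.^ t ])

inZt? : (p k r t : ℕ) → Decidable (InZt p k r t)
inZt? p k r t w = liftOfΩ? p k r w
  ×-dec vEq? (p ℕ.^ r) (first {k = k} w) ℤ.1ℤ (+ 0)
  ×-dec (num (last {k = k} w) ≡? ε k [mod p ])
  ×-dec (den (last {k = k} w) ≡? + 0 [mod p ])
  ×-dec ((p ℕ.^ t) ∣? toℕ (proj₂ (last {k = k} w)))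
  ×-dec ¬? ((p ℕ.^ suc t) ∣? toℕ (proj₂ (last {k = k} w)))
  ×-dec (num (last {k = k} w) ≡? ε k [mod p ℕ.^ t ])

∣Z∣ : (p k r : ℕ) → ℕ
∣Z∣ p k r = length (filter (inZ? p k r) (Seqs (p ℕ.^ r) k))

∣Zt∣ : (p k r t : ℕ) → ℕ
∣Zt∣ p k r t = length (filter (inZt? p k r t) (Seqs (p ℕ.^ r) k))

module Submission where

-- Write N = p^(r-1), so that every pair modulo pN is uniquely the lift
-- (y + N s)/(y′ + N s′) of a pair y/y′ modulo N, with s, s′ ∈ {0,…,p-1}. If y/y′ is a
-- neighbour of u = a/b modulo N, say det(u, y/y′) = 1 + eN, then the lifts that are
-- neighbours of u modulo pN are the solutions of the single linear congruence
-- a s′ - b s + e ≡ 0 (mod p), and a, b are not both divisible by p. So there are exactly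
-- p such lifts, and exactly p - 1 with s′ ≠ 0 when y′ = 0 (then b is invertible mod p).
-- Counting the paths of Z_k(r, t) vertex by vertex, each of the 2k steps therefore
-- contributes a factor p as long as the condition on the final vertex only depends on it
-- modulo N, which is the case for t < r - 1. For t = r - 1 the final condition on a lift
-- says exactly that y/y′ = ε/0 modulo N and s′ ≠ 0, and the last factor p becomes p - 1.

open import Defs

open import Data.Nat as ℕ using (ℕ; zero; suc)
import Data.Nat.Properties as ℕP
open import Data.Nat.Divisibility as ℕ∣ using ()
open import Data.Nat.Primality using (Prime; euclidsLemma; prime⇒nonZero; prime⇒nonTrivial; prime⇒irreducible)
import Data.Integer as ℤ
import Data.Integer.Properties as ℤP
import Data.Integer.DivMod as ℤ/
import Data.Integer.Divisibility.Signed as ℤ∣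
open import Data.Fin as Fin using (Fin; zero; suc; toℕ; _↑ˡ_; _↑ʳ_; combine)
import Data.Fin.Properties as FinP
open import Data.List as List using (List; []; _∷_; _++_; map; concatMap; cartesianProduct; allFin; length; filter)
open import Data.Vec using (Vec; []; _∷_)
open import Data.Product using (∃; _×_; _,_; proj₁; proj₂)
open import Data.Sum using (_⊎_; inj₁; inj₂)
open import Function using (_∘_; id; _⇔_; mk⇔; Equivalence)
open import Level using (Level)
open import Relation.Nullary using (¬_; ¬?; Dec; yes; no; contradiction)
open import Relation.Nullary.Decidable using (_×-dec_; map′)
open import Relation.Unary using (Pred; Decidable)
open import Relation.Binary.Bundles using (Setoid)
open import Relation.Binary.PropositionalEquality
open import Algebra.Properties.Semiring.Sum ℕP.+-*-semiring
  using (sum; sum-syntax; sum-cong-≗; ∑-comm; *-distribˡ-sum; *-distribʳ-sum)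

private
  variable
    ℓ ℓ′ : Level
    A : Set ℓ
    B : Set ℓ′

module _ where
  open import Data.Nat using (_+_; _*_)

  ∑-const : ∀ n c → ∑[ i < n ] c ≡ n * c
  ∑-const zero    c = refl
  ∑-const (suc n) c = cong (c +_) (∑-const n c)

  ∑-zero : ∀ n {f : Fin n → ℕ} → (∀ i → f i ≡ 0) → sum f ≡ 0
  ∑-zero n f≡0 = trans (sum-cong-≗ f≡0) (trans (∑-const n 0) (ℕP.*-zeroʳ n))

  *-distribˡ-∑∑ : ∀ {m n} c (f : Fin m → Fin n → ℕ) →
                  c * (∑[ i < m ] ∑[ j < n ] f i j) ≡ ∑[ i < m ] ∑[ j < n ] (c * f i j)
  *-distribˡ-∑∑ c f = trans (*-distribˡ-sum c (λ i → ∑[ j < _ ] f i j)) (sum-cong-≗ (λ i → *-distribˡ-sum c (f i)))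

  ∑∑-cong : ∀ {m n} {f g : Fin m → Fin n → ℕ} → (∀ i j → f i j ≡ g i j) →
            ∑[ i < m ] ∑[ j < n ] f i j ≡ ∑[ i < m ] ∑[ j < n ] g i j
  ∑∑-cong f≡g = sum-cong-≗ (λ i → sum-cong-≗ (f≡g i))

  ∑-++ : ∀ m n (f : Fin (m + n) → ℕ) → sum f ≡ ∑[ i < m ] f (i ↑ˡ n) + ∑[ j < n ] f (m ↑ʳ j)
  ∑-++ zero    n f = refl
  ∑-++ (suc m) n f = trans (cong (f zero +_) (∑-++ m n (f ∘ suc))) (sym (ℕP.+-assoc (f zero) _ _))

  ∑-combine : ∀ m n (f : Fin (m * n) → ℕ) → sum f ≡ ∑[ i < m ] ∑[ j < n ] f (combine i j)
  ∑-combine zero    n f = refl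
  ∑-combine (suc m) n f =
    trans (∑-++ n (m * n) f) (cong (∑[ j < n ] f (j ↑ˡ m * n) +_) (∑-combine m n (f ∘ (n ↑ʳ_))))

  ∑-single : ∀ {n} (f : Fin n → ℕ) i → (∀ j → j ≢ i → f j ≡ 0) → sum f ≡ f i
  ∑-single {suc n} f zero    f≡0 =
    trans (cong (f zero +_) (∑-zero n (λ j → f≡0 (suc j) λ ()))) (ℕP.+-identityʳ _)
  ∑-single {suc n} f (suc i) f≡0 =
    trans (cong (_+ ∑[ j < n ] f (suc j)) (f≡0 zero λ ()))
          (∑-single (f ∘ suc) i (λ j j≢i → f≡0 (suc j) (j≢i ∘ FinP.suc-injective)))

module _ where
  open import Data.Nat using (_+_; _*_; _∸_; _≟_)

  𝟙 : Dec A → ℕ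
  𝟙 (yes _) = 1
  𝟙 (no _)  = 0

  𝟙-≡1 : (A? : Dec A) → A → 𝟙 A? ≡ 1
  𝟙-≡1 (yes _) _ = refl
  𝟙-≡1 (no ¬a) a = contradiction a ¬a

  𝟙-≡0 : (A? : Dec A) → ¬ A → 𝟙 A? ≡ 0
  𝟙-≡0 (yes a) ¬a = contradiction a ¬a
  𝟙-≡0 (no _)  _  = refl

  𝟙-cong : (A? : Dec A) (B? : Dec B) → A ⇔ B → 𝟙 A? ≡ 𝟙 B?
  𝟙-cong A? (yes b) A⇔B = 𝟙-≡1 A? (Equivalence.from A⇔B b)
  𝟙-cong A? (no ¬b) A⇔B = 𝟙-≡0 A? (¬b ∘ Equivalence.to A⇔B)

  𝟙-× : (A? : Dec A) (B? : Dec B) → 𝟙 (A? ×-dec B?) ≡ 𝟙 A? * 𝟙 B?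
  𝟙-× (yes _) (yes _) = refl
  𝟙-× (yes _) (no _)  = refl
  𝟙-× (no _)  _       = refl

  ∑-𝟙-unique : ∀ {n p} {P : Pred (Fin n) p} (P? : Decidable P) {i} → P i → (∀ {j} → P j → j ≡ i) →
               ∑[ j < n ] 𝟙 (P? j) ≡ 1
  ∑-𝟙-unique P? {i} Pi unique =
    trans (∑-single (𝟙 ∘ P?) i (λ j j≢i → 𝟙-≡0 (P? j) (j≢i ∘ unique))) (𝟙-≡1 (P? i) Pi)

  ∑-𝟙-nonzero : ∀ n → ∑[ i < n ] 𝟙 (¬? (toℕ i ≟ 0)) ≡ n ∸ 1
  ∑-𝟙-nonzero zero    = refl
  ∑-𝟙-nonzero (suc n) = trans (∑-const n 1) (ℕP.*-identityʳ n)

  sumOver : List A → (A → ℕ) → ℕ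
  sumOver xs f = List.foldr (λ x s → f x + s) 0 xs

  infix 5 sumOver
  syntax sumOver xs (λ x → e) = ∑[ x ∈ xs ] e

  length-filter≡∑𝟙 : ∀ {p} {P : Pred A p} (P? : Decidable P) xs →
                     length (filter P? xs) ≡ ∑[ x ∈ xs ] 𝟙 (P? x)
  length-filter≡∑𝟙 P? []       = refl
  length-filter≡∑𝟙 P? (x ∷ xs) with P? x
  ... | yes _ = cong suc (length-filter≡∑𝟙 P? xs)
  ... | no _  = length-filter≡∑𝟙 P? xs

  sumOver-cong : ∀ (xs : List A) {f g : A → ℕ} → (∀ x → f x ≡ g x) → sumOver xs f ≡ sumOver xs g
  sumOver-cong []       f≡g = refl
  sumOver-cong (x ∷ xs) f≡g = cong₂ _+_ (f≡g x) (sumOver-cong xs f≡g)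

  sumOver-++ : ∀ (xs ys : List A) f → sumOver (xs ++ ys) f ≡ sumOver xs f + sumOver ys f
  sumOver-++ []       ys f = refl
  sumOver-++ (x ∷ xs) ys f = trans (cong (f x +_) (sumOver-++ xs ys f)) (sym (ℕP.+-assoc (f x) _ _))

  *-distribˡ-sumOver : ∀ c (xs : List A) f → c * sumOver xs f ≡ ∑[ x ∈ xs ] c * f x
  *-distribˡ-sumOver c []       f = ℕP.*-zeroʳ c
  *-distribˡ-sumOver c (x ∷ xs) f = trans (ℕP.*-distribˡ-+ c (f x) _) (cong (c * f x +_) (*-distribˡ-sumOver c xs f))

  sumOver-map : ∀ (g : A → B) xs f → sumOver (map g xs) f ≡ sumOver xs (f ∘ g)
  sumOver-map g []       f = refl
  sumOver-map g (x ∷ xs) f = cong (f (g x) +_) (sumOver-map g xs f)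

  sumOver-concatMap : ∀ (g : A → List B) xs f → sumOver (concatMap g xs) f ≡ ∑[ x ∈ xs ] sumOver (g x) f
  sumOver-concatMap g []       f = refl
  sumOver-concatMap g (x ∷ xs) f =
    trans (sumOver-++ (g x) _ f) (cong (sumOver (g x) f +_) (sumOver-concatMap g xs f))

  sumOver-cartesianProduct : ∀ (xs : List A) (ys : List B) f →
    sumOver (cartesianProduct xs ys) f ≡ ∑[ x ∈ xs ] ∑[ y ∈ ys ] f (x , y)
  sumOver-cartesianProduct []       ys f = refl
  sumOver-cartesianProduct (x ∷ xs) ys f =
    trans (sumOver-++ (map (x ,_) ys) _ f) (cong₂ _+_ (sumOver-map (x ,_) ys f) (sumOver-cartesianProduct xs ys f))

  sumOver-tabulate : ∀ n (g : Fin n → A) f → sumOver (List.tabulate g) f ≡ ∑[ i < n ] f (g i)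
  sumOver-tabulate zero    g f = refl
  sumOver-tabulate (suc n) g f = cong (f (g zero) +_) (sumOver-tabulate n (g ∘ suc) f)

  sumOver-allFin : ∀ n f → sumOver (allFin n) f ≡ sum f
  sumOver-allFin n = sumOver-tabulate n id

  sumOver-allVecs : ∀ {A : Set} m (xs : List A) f →
    sumOver (allVecs (suc m) xs) f ≡ ∑[ x ∈ xs ] ∑[ ws ∈ allVecs m xs ] f (x ∷ ws)
  sumOver-allVecs m xs f =
    trans (sumOver-concatMap _ xs f) (sumOver-cong xs λ x → sumOver-map (x ∷_) (allVecs m xs) f)

  sumOver-allPairs : ∀ n f → sumOver (allPairs n) f ≡ ∑[ a < n ] ∑[ b < n ] f (a , b)
  sumOver-allPairs n f = begin
    sumOver (allPairs n) f
      ≡⟨ sumOver-cartesianProduct (allFin n) (allFin n) f ⟩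
    ∑[ a ∈ allFin n ] ∑[ b ∈ allFin n ] f (a , b)
      ≡⟨ sumOver-cong (allFin n) (λ a → sumOver-allFin n (λ b → f (a , b))) ⟩
    ∑[ a ∈ allFin n ] ∑[ b < n ] f (a , b)
      ≡⟨ sumOver-allFin n (λ a → ∑[ b < n ] f (a , b)) ⟩
    ∑[ a < n ] ∑[ b < n ] f (a , b) ∎
    where open ≡-Reasoning

  sumOver-allPairs-single : ∀ {n} (o : Pair n) f → (∀ x → x ≢ o → f x ≡ 0) → sumOver (allPairs n) f ≡ f o
  sumOver-allPairs-single {n} (a₀ , b₀) f f≡0 = begin
    sumOver (allPairs n) f
      ≡⟨ sumOver-allPairs n f ⟩
    ∑[ a < n ] ∑[ b < n ] f (a , b)
      ≡⟨ ∑-single (λ a → ∑[ b < n ] f (a , b)) a₀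
                  (λ a a≢a₀ → ∑-zero n (λ b → f≡0 (a , b) (a≢a₀ ∘ cong proj₁))) ⟩
    ∑[ b < n ] f (a₀ , b)
      ≡⟨ ∑-single (λ b → f (a₀ , b)) b₀ (λ b b≢b₀ → f≡0 (a₀ , b) (b≢b₀ ∘ cong proj₂)) ⟩
    f (a₀ , b₀) ∎
    where open ≡-Reasoning

module _ where
  open import Data.List.Membership.Propositional using (_∈_)
  open import Data.List.Membership.Propositional.Properties
    using (∈-map⁺; ∈-concatMap⁺; ∈-allFin; ∈-cartesianProduct⁺)
  import Data.List.Relation.Unary.Any as Any

  ∈-allVecs : ∀ {A : Set} {xs : List A} → (∀ x → x ∈ xs) → ∀ {m} (ws : Vec A m) → ws ∈ allVecs m xs
  ∈-allVecs x∈xs []                = Any.here refl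
  ∈-allVecs {xs = xs} x∈xs {suc m} (x ∷ ws) =
    ∈-concatMap⁺ (λ y → map (y ∷_) (allVecs m xs))
                 (Any.map (λ { refl → ∈-map⁺ (x ∷_) (∈-allVecs x∈xs ws) }) (x∈xs x))

  ∈-allPairs : ∀ {n} (x : Pair n) → x ∈ allPairs n
  ∈-allPairs (a , b) = ∈-cartesianProduct⁺ (∈-allFin a) (∈-allFin b)

module _ where
  open import Data.Integer using (ℤ; +_; _+_; _-_; _*_; -_; 0ℤ; 1ℤ)
  open ℤ∣ using (_∣_)
  open import Data.Integer.Tactic.RingSolver using (solve-∀)

  private
    variable
      m n : ℕ
      x x′ y y′ z : ℤ

  infix 4 _≈_[mod_] _≈?_[mod_]

  -- x ≡ y [mod n ] as a record, so that x, y and n can be inferred from the type.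
  record _≈_[mod_] (x y : ℤ) (n : ℕ) : Set where
    constructor mod
    field divides : + n ∣ x - y

  ≡mod⇒≈ : x ≡ y [mod n ] → x ≈ y [mod n ]
  ≡mod⇒≈ = mod ∘ ℤ∣.∣ᵤ⇒∣

  ≈⇒≡mod : x ≈ y [mod n ] → x ≡ y [mod n ]
  ≈⇒≡mod (mod n∣x-y) = ℤ∣.∣⇒∣ᵤ n∣x-y

  _≈?_[mod_] : ∀ x y n → Dec (x ≈ y [mod n ])
  x ≈? y [mod n ] = map′ ≡mod⇒≈ ≈⇒≡mod (x ≡? y [mod n ])

  private
    x-x≡0 : ∀ x → x - x ≡ 0ℤ
    x-x≡0 = solve-∀
    y-x≡-[x-y] : ∀ x y → y - x ≡ - (x - y)
    y-x≡-[x-y] = solve-∀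
    x-z≡[x-y]+[y-z] : ∀ x y z → x - z ≡ (x - y) + (y - z)
    x-z≡[x-y]+[y-z] = solve-∀
    +-minus-+ : ∀ x y x′ y′ → (x + y) - (x′ + y′) ≡ (x - x′) + (y - y′)
    +-minus-+ = solve-∀
    neg-minus-neg : ∀ x y → - x - - y ≡ - (x - y)
    neg-minus-neg = solve-∀
    *-minus-* : ∀ x y x′ y′ → x * y - x′ * y′ ≡ x * (y - y′) + (x - x′) * y′
    *-minus-* = solve-∀
    x-0≡x : ∀ x → x - 0ℤ ≡ x
    x-0≡x = solve-∀

  ≈-reflexive : x ≡ y → x ≈ y [mod n ]
  ≈-reflexive {x} refl = mod (ℤ∣.divides 0ℤ (x-x≡0 x))

  ≈-refl : x ≈ x [mod n ]
  ≈-refl = ≈-reflexive refl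

  ≈-sym : x ≈ y [mod n ] → y ≈ x [mod n ]
  ≈-sym {x} {y} (mod d) = mod (subst (_ ∣_) (sym (y-x≡-[x-y] x y)) (ℤ∣.∣m⇒∣-m d))

  ≈-trans : x ≈ y [mod n ] → y ≈ z [mod n ] → x ≈ z [mod n ]
  ≈-trans {x} {y} {z = z} (mod d) (mod e) =
    mod (subst (_ ∣_) (sym (x-z≡[x-y]+[y-z] x y z)) (ℤ∣.∣m∣n⇒∣m+n d e))

  +-cong-≈ : x ≈ x′ [mod n ] → y ≈ y′ [mod n ] → x + y ≈ x′ + y′ [mod n ]
  +-cong-≈ {x} {x′} {y = y} {y′} (mod d) (mod e) =
    mod (subst (_ ∣_) (sym (+-minus-+ x y x′ y′)) (ℤ∣.∣m∣n⇒∣m+n d e))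

  neg-cong-≈ : x ≈ y [mod n ] → - x ≈ - y [mod n ]
  neg-cong-≈ {x} {y} (mod d) = mod (subst (_ ∣_) (sym (neg-minus-neg x y)) (ℤ∣.∣m⇒∣-m d))

  −-cong-≈ : x ≈ x′ [mod n ] → y ≈ y′ [mod n ] → x - y ≈ x′ - y′ [mod n ]
  −-cong-≈ x≈x′ y≈y′ = +-cong-≈ x≈x′ (neg-cong-≈ y≈y′)

  *-cong-≈ : x ≈ x′ [mod n ] → y ≈ y′ [mod n ] → x * y ≈ x′ * y′ [mod n ]
  *-cong-≈ {x} {x′} {y = y} {y′} (mod d) (mod e) =
    mod (subst (_ ∣_) (sym (*-minus-* x y x′ y′))
               (ℤ∣.∣m∣n⇒∣m+n (ℤ∣.∣n⇒∣m*n x e) (ℤ∣.∣m⇒∣m*n y′ d)))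

  ≈-weaken : m ℕ∣.∣ n → x ≈ y [mod n ] → x ≈ y [mod m ]
  ≈-weaken m∣n (mod d) = mod (ℤ∣.∣-trans (ℤ∣.∣ᵤ⇒∣ m∣n) d)

  ≈0⇔∣ : x ≈ 0ℤ [mod n ] ⇔ + n ∣ x
  ≈0⇔∣ {x} = mk⇔ (λ (mod d) → subst (_ ∣_) (x-0≡x x) d) (λ d → mod (subst (_ ∣_) (sym (x-0≡x x)) d))

  ∣⇒≈0 : ∀ {a} → m ℕ∣.∣ a → + a ≈ 0ℤ [mod m ]
  ∣⇒≈0 = Equivalence.from ≈0⇔∣ ∘ ℤ∣.∣ᵤ⇒∣

  ≈-setoid : ℕ → Setoid _ _
  ≈-setoid n = record
    { Carrier       = ℤ
    ; _≈_           = _≈_[mod n ]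
    ; isEquivalence = record { refl = ≈-refl ; sym = ≈-sym ; trans = ≈-trans }
    }

  module ≈-Reasoning (n : ℕ) where
    open import Relation.Binary.Reasoning.Setoid (≈-setoid n) public

  −≈0⇔≈ : x - y ≈ 0ℤ [mod n ] ⇔ x ≈ y [mod n ]
  −≈0⇔≈ = mk⇔ (mod ∘ Equivalence.to ≈0⇔∣) (λ (mod d) → Equivalence.from ≈0⇔∣ d)

  *-cancel-≈0 : ∀ {z} m n .{{_ : ℕ.NonZero n}} → + n * z ≈ 0ℤ [mod m ℕ.* n ] ⇔ z ≈ 0ℤ [mod m ]
  *-cancel-≈0 {z} m n = mk⇔
    (λ nz≈0 → Equivalence.from ≈0⇔∣
                (ℤ∣.*-cancelˡ-∣ (+ n) (subst (_∣ + n * z) +[m*n]≡+n*+m (Equivalence.to ≈0⇔∣ nz≈0))))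
    (λ z≈0 → Equivalence.from ≈0⇔∣
               (subst (_∣ + n * z) (sym +[m*n]≡+n*+m) (ℤ∣.*-monoʳ-∣ (+ n) (Equivalence.to ≈0⇔∣ z≈0))))
    where
    +[m*n]≡+n*+m : + (m ℕ.* n) ≡ + n * + m
    +[m*n]≡+n*+m = trans (ℤP.pos-* m n) (ℤP.*-comm (+ m) (+ n))

  +[n*q+r]≈+r : ∀ n q r → + (n ℕ.* q ℕ.+ r) ≈ + r [mod n ]
  +[n*q+r]≈+r n q r = mod (ℤ∣.divides (+ q) (begin
    + (n ℕ.* q ℕ.+ r) - + r  ≡⟨ cong (_- + r) (ℤP.pos-+ (n ℕ.* q) r) ⟩
    + (n ℕ.* q) + + r - + r  ≡⟨ a+b-b≡a (+ (n ℕ.* q)) (+ r) ⟩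
    + (n ℕ.* q)              ≡⟨ ℤP.pos-* n q ⟩
    + n * + q                ≡⟨ ℤP.*-comm (+ n) (+ q) ⟩
    + q * + n                ∎))
    where
    open ≡-Reasoning
    a+b-b≡a : ∀ a b → a + b - b ≡ a
    a+b-b≡a = solve-∀

  ¬1≈0 : 1 ℕ.< n → ¬ 1ℤ ≈ 0ℤ [mod n ]
  ¬1≈0 1<n 1≈0 = ℕP.<⇒≢ 1<n (sym (ℕ∣.∣1⇒≡1 (≈⇒≡mod 1≈0)))

  ^-monoʳ-∣ : ∀ m {a b} → a ℕ.≤ b → m ℕ.^ a ℕ∣.∣ m ℕ.^ b
  ^-monoʳ-∣ m {a} {b} a≤b =
    subst (λ c → m ℕ.^ a ℕ∣.∣ m ℕ.^ c) (ℕP.m+[n∸m]≡n a≤b)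
          (subst (m ℕ.^ a ℕ∣.∣_) (sym (ℕP.^-distribˡ-+-* m a (b ℕ.∸ a))) (ℕ∣.m∣m*n (m ℕ.^ (b ℕ.∸ a))))

  ∣∧<⇒≡0 : ∀ {a} → n ℕ∣.∣ a → a ℕ.< n → a ≡ 0
  ∣∧<⇒≡0 {a = zero}  _   _   = refl
  ∣∧<⇒≡0 {a = suc _} n∣a a<n = contradiction n∣a (ℕ∣.>⇒∤ a<n)

  toℕ≈0⇒≡0 : (s : Fin n) → + toℕ s ≈ 0ℤ [mod n ] → toℕ s ≡ 0
  toℕ≈0⇒≡0 s s≈0 = ∣∧<⇒≡0 (ℤ∣.∣⇒∣ᵤ (Equivalence.to ≈0⇔∣ s≈0)) (FinP.toℕ<n s)

  ≡mod-resp-≈ : ∀ {c} → m ℕ∣.∣ n → x ≈ y [mod n ] → x ≡ c [mod m ] → y ≡ c [mod m ]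
  ≡mod-resp-≈ {x = x} m∣n x≈y x≡c =
    ≈⇒≡mod (≈-trans (≈-sym (≈-weaken m∣n x≈y)) (≡mod⇒≈ {x = x} x≡c))

  ∣-resp-≈ : ∀ {a b} → m ℕ∣.∣ n → + a ≈ + b [mod n ] → m ℕ∣.∣ a → m ℕ∣.∣ b
  ∣-resp-≈ m∣n a≈b m∣a =
    ℤ∣.∣⇒∣ᵤ (Equivalence.to ≈0⇔∣ (≈-trans (≈-sym (≈-weaken m∣n a≈b)) (∣⇒≈0 m∣a)))

  ≈-toℕ-injective : (s t : Fin n) → + toℕ s ≈ + toℕ t [mod n ] → s ≡ t
  ≈-toℕ-injective {n} s t s≈t =
    FinP.toℕ-injective (ℤP.+-injective (ℤP.i-j≡0⇒i≡j _ _ (ℤP.∣i∣≡0⇒i≡0 ∣s-t∣≡0)))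
    where
    ∣s-t∣ = ℤ.∣ + toℕ s - + toℕ t ∣
    ∣s-t∣<n : ∣s-t∣ ℕ.< n
    ∣s-t∣<n = ℕP.≤-<-trans
      (subst (ℕ._≤ toℕ s ℕ.⊔ toℕ t) (cong ℤ.∣_∣ (sym (ℤP.m-n≡m⊖n (toℕ s) (toℕ t))))
             (ℤP.∣m⊝n∣≤m⊔n (toℕ s) (toℕ t)))
      (ℕP.⊔-lub (FinP.toℕ<n s) (FinP.toℕ<n t))
    ∣s-t∣≡0 : ∣s-t∣ ≡ 0
    ∣s-t∣≡0 = ∣∧<⇒≡0 (≈⇒≡mod s≈t) ∣s-t∣<n

  residue : ℤ → (n : ℕ) .{{_ : ℕ.NonZero n}} → Fin n
  residue z n = Fin.fromℕ< (ℤ/.n%ℕd<d z n)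

  residue-≈ : ∀ z n .{{_ : ℕ.NonZero n}} → + toℕ (residue z n) ≈ z [mod n ]
  residue-≈ z n = ≈-sym (mod (ℤ∣.divides q (begin
    z - + toℕ (residue z n)  ≡⟨ cong (λ r → z - + r) (FinP.toℕ-fromℕ< (ℤ/.n%ℕd<d z n)) ⟩
    z - + r                  ≡⟨ cong (_- + r) (ℤ/.a≡a%ℕn+[a/ℕn]*n z n) ⟩
    + r + q * + n - + r      ≡⟨ a+b-a≡b (+ r) (q * + n) ⟩
    q * + n                  ∎)))
    where
    open ≡-Reasoning
    q = z ℤ/./ℕ n
    r = z ℤ/.%ℕ n
    a+b-a≡b : ∀ a b → a + b - a ≡ b
    a+b-a≡b = solve-∀

-- Linear congruences modulo a prime

module _ {p : ℕ} (p-prime : Prime p) where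
  open import Data.Integer using (ℤ; +_; _+_; _-_; _*_; -_; 0ℤ; 1ℤ)
  open import Data.Nat.Coprimality using (Coprime; coprime-Bézout)
  open import Data.Nat.GCD using (module Bézout)
  open import Data.Integer.Tactic.RingSolver using (solve-∀)

  private
    instance
      p≢0 : ℕ.NonZero p
      p≢0 = prime⇒nonZero p-prime

  ∤⇒coprime : ∀ {m} → ¬ p ℕ∣.∣ m → Coprime p m
  ∤⇒coprime p∤m (d∣p , d∣m) with prime⇒irreducible p-prime d∣p
  ... | inj₁ d≡1 = d≡1
  ... | inj₂ refl = contradiction d∣m p∤m

  *≈0⇒≈0⊎≈0 : ∀ {x y} → x * y ≈ 0ℤ [mod p ] → x ≈ 0ℤ [mod p ] ⊎ y ≈ 0ℤ [mod p ]
  *≈0⇒≈0⊎≈0 {x} {y} xy≈0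
    with euclidsLemma ℤ.∣ x ∣ ℤ.∣ y ∣ p-prime
           (subst (p ℕ∣.∣_) (ℤP.abs-* x y) (ℤ∣.∣⇒∣ᵤ (Equivalence.to ≈0⇔∣ xy≈0)))
  ... | inj₁ p∣x = inj₁ (Equivalence.from ≈0⇔∣ (ℤ∣.∣ᵤ⇒∣ p∣x))
  ... | inj₂ p∣y = inj₂ (Equivalence.from ≈0⇔∣ (ℤ∣.∣ᵤ⇒∣ p∣y))

  private
    embed-Bézout : ∀ {a b c d} → 1 ℕ.+ a ℕ.* b ≡ c ℕ.* d → 1ℤ + + a * + b ≡ + c * + d
    embed-Bézout {a} {b} {c} {d} eq = begin
      1ℤ + + a * + b      ≡⟨ cong (λ z → 1ℤ + z) (ℤP.pos-* a b) ⟨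
      + (1 ℕ.+ a ℕ.* b)   ≡⟨ cong +_ eq ⟩
      + (c ℕ.* d)         ≡⟨ ℤP.pos-* c d ⟩
      + c * + d           ∎
      where open ≡-Reasoning
    1+bm≡ap⇒m[-b]-1≡[-a]p : ∀ a b m p → 1ℤ + b * m ≡ a * p → m * - b - 1ℤ ≡ - a * p
    1+bm≡ap⇒m[-b]-1≡[-a]p a b m p eq = trans (lhs≡ b m) (trans (cong -_ eq) (rhs≡ a p))
      where
      lhs≡ : ∀ b m → m * - b - 1ℤ ≡ - (1ℤ + b * m)
      lhs≡ = solve-∀
      rhs≡ : ∀ a p → - (a * p) ≡ - a * p
      rhs≡ = solve-∀
    1+ap≡bm⇒mb-1≡ap : ∀ a b m p → 1ℤ + a * p ≡ b * m → m * b - 1ℤ ≡ a * p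
    1+ap≡bm⇒mb-1≡ap a b m p eq = trans (cong (_- 1ℤ) (trans (ℤP.*-comm m b) (sym eq))) (1+x-1≡x (a * p))
      where
      1+x-1≡x : ∀ x → 1ℤ + x - 1ℤ ≡ x
      1+x-1≡x = solve-∀

  ≈-inverse-ℕ : ∀ {m} → ¬ p ℕ∣.∣ m → ∃ λ ι → + m * ι ≈ 1ℤ [mod p ]
  ≈-inverse-ℕ {m} p∤m with coprime-Bézout (∤⇒coprime p∤m)
  ... | Bézout.+- a b eq =
    - + b , mod (ℤ∣.divides (- + a) (1+bm≡ap⇒m[-b]-1≡[-a]p (+ a) (+ b) (+ m) (+ p) (embed-Bézout {b} {m} {a} {p} eq)))
  ... | Bézout.-+ a b eq =
    + b , mod (ℤ∣.divides (+ a) (1+ap≡bm⇒mb-1≡ap (+ a) (+ b) (+ m) (+ p) (embed-Bézout {a} {p} {b} {m} eq)))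

  ≈-inverse : ∀ {x} → ¬ x ≈ 0ℤ [mod p ] → ∃ λ ι → x * ι ≈ 1ℤ [mod p ]
  ≈-inverse {x} x≉0 with ≈-inverse-ℕ (x≉0 ∘ Equivalence.from ≈0⇔∣ ∘ ℤ∣.∣ᵤ⇒∣) | ℤP.+∣i∣≡i⊎+∣i∣≡-i x
  ... | ι , ∣x∣ι≈1 | inj₁ ∣x∣≡x  = ι , subst (λ x → x * ι ≈ 1ℤ [mod p ]) ∣x∣≡x ∣x∣ι≈1
  ... | ι , ∣x∣ι≈1 | inj₂ ∣x∣≡-x =
    - ι , subst (_≈ 1ℤ [mod p ]) (trans (cong (_* ι) ∣x∣≡-x) (-x*y≡x*-y x ι)) ∣x∣ι≈1
    where
    -x*y≡x*-y : ∀ x y → - x * y ≡ x * - y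
    -x*y≡x*-y = solve-∀

  private
    γ+β[-γι]≡γ-γ[βι] : ∀ γ β ι → γ + β * (- γ * ι) ≡ γ - γ * (β * ι)
    γ+β[-γι]≡γ-γ[βι] = solve-∀
    γ-γ1≡0 : ∀ γ → γ - γ * 1ℤ ≡ 0ℤ
    γ-γ1≡0 = solve-∀
    [γ+βs]-[γ+βt]≡β[s-t] : ∀ γ β s t → (γ + β * s) - (γ + β * t) ≡ β * (s - t)
    [γ+βs]-[γ+βt]≡β[s-t] = solve-∀

  linear-root : ∀ γ {β} → ¬ β ≈ 0ℤ [mod p ] → ∃ λ (s : Fin p) → γ + β * + toℕ s ≈ 0ℤ [mod p ]
  linear-root γ {β} β≉0 with ≈-inverse β≉0
  ... | ι , βι≈1 = residue (- γ * ι) p , (begin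
    γ + β * + toℕ (residue (- γ * ι) p)
      ≈⟨ +-cong-≈ (≈-refl {x = γ}) (*-cong-≈ (≈-refl {x = β}) (residue-≈ (- γ * ι) p)) ⟩
    γ + β * (- γ * ι)
      ≡⟨ γ+β[-γι]≡γ-γ[βι] γ β ι ⟩
    γ - γ * (β * ι)
      ≈⟨ −-cong-≈ (≈-refl {x = γ}) (*-cong-≈ (≈-refl {x = γ}) βι≈1) ⟩
    γ - γ * 1ℤ
      ≡⟨ γ-γ1≡0 γ ⟩
    0ℤ ∎)
    where open ≈-Reasoning p

  linear-root-unique : ∀ γ {β} → ¬ β ≈ 0ℤ [mod p ] → (s t : Fin p) →
    γ + β * + toℕ s ≈ 0ℤ [mod p ] → γ + β * + toℕ t ≈ 0ℤ [mod p ] → s ≡ t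
  linear-root-unique γ {β} β≉0 s t s-root t-root with *≈0⇒≈0⊎≈0 β[s-t]≈0
    where
    β[s-t]≈0 : β * (+ toℕ s - + toℕ t) ≈ 0ℤ [mod p ]
    β[s-t]≈0 = subst (_≈ 0ℤ [mod p ]) ([γ+βs]-[γ+βt]≡β[s-t] γ β (+ toℕ s) (+ toℕ t))
                     (−-cong-≈ s-root t-root)
  ... | inj₁ β≈0   = contradiction β≈0 β≉0
  ... | inj₂ s-t≈0 = ≈-toℕ-injective s t (Equivalence.to −≈0⇔≈ s-t≈0)

  ∑-𝟙-linear-root : ∀ γ {β} → ¬ β ≈ 0ℤ [mod p ] → ∑[ s < p ] 𝟙 (γ + β * + toℕ s ≈? 0ℤ [mod p ]) ≡ 1
  ∑-𝟙-linear-root γ {β} β≉0 = ∑-𝟙-unique (λ s → γ + β * + toℕ s ≈? 0ℤ [mod p ]) {root} root-is-root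
                                 (λ {s} s-is-root → linear-root-unique γ β≉0 s root s-is-root root-is-root)
    where
    root = proj₁ (linear-root γ β≉0)
    root-is-root = proj₂ (linear-root γ β≉0)

module _ where
  open import Data.Integer using (ℤ; +_; _-_; _*_; 0ℤ; 1ℤ)
  open import Data.Nat.GCD using (gcd; gcd[m,n]∣m; gcd[m,n]∣n)
  open import Data.Fin using (inject₁)
  open import Data.Vec using (lookup)
  open import Data.Integer.Tactic.RingSolver using (solve-∀)

  private
    variable
      d l m n : ℕ

  infix 4 _≈ᴾ_[mod_]

  _≈ᴾ_[mod_] : Pair m → Pair l → ℕ → Set
  u ≈ᴾ v [mod n ] = num u ≈ num v [mod n ] × den u ≈ den v [mod n ]

  ≈ᴾ-refl : {u : Pair m} → u ≈ᴾ u [mod n ]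
  ≈ᴾ-refl = ≈-refl , ≈-refl

  ≈ᴾ-sym : {u : Pair m} {v : Pair l} → u ≈ᴾ v [mod n ] → v ≈ᴾ u [mod n ]
  ≈ᴾ-sym (a≈c , b≈d) = ≈-sym a≈c , ≈-sym b≈d

  ≈ᴾ-trans : {u : Pair m} {v : Pair l} {w : Pair d} →
             u ≈ᴾ v [mod n ] → v ≈ᴾ w [mod n ] → u ≈ᴾ w [mod n ]
  ≈ᴾ-trans (a≈c , b≈d) (c≈e , d≈f) = ≈-trans a≈c c≈e , ≈-trans b≈d d≈f

  ≈ᴾ-weaken : {u : Pair m} {v : Pair l} → d ℕ∣.∣ n → u ≈ᴾ v [mod n ] → u ≈ᴾ v [mod d ]
  ≈ᴾ-weaken d∣n (a≈c , b≈d) = ≈-weaken d∣n a≈c , ≈-weaken d∣n b≈d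

  det : Pair m → Pair l → ℤ
  det v w = num v * den w - den v * num w

  det-cong : ∀ {m′ l′} {u : Pair m} {u′ : Pair m′} {v : Pair l} {v′ : Pair l′} →
             u ≈ᴾ u′ [mod n ] → v ≈ᴾ v′ [mod n ] → det u v ≈ det u′ v′ [mod n ]
  det-cong (a≈a′ , b≈b′) (c≈c′ , d≈d′) = −-cong-≈ (*-cong-≈ a≈a′ d≈d′) (*-cong-≈ b≈b′ c≈c′)

  edge⇔det≈1 : {u v : Pair n} → Edge n u v ⇔ det u v ≈ 1ℤ [mod n ]
  edge⇔det≈1 = mk⇔ ≡mod⇒≈ ≈⇒≡mod

  private
    0d-0c≡0 : ∀ d c → 0ℤ * d - 0ℤ * c ≡ 0ℤ
    0d-0c≡0 = solve-∀
    a0-b0≡0 : ∀ a b → a * 0ℤ - b * 0ℤ ≡ 0ℤ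
    a0-b0≡0 = solve-∀
    a0-0c≡0 : ∀ a c → a * 0ℤ - 0ℤ * c ≡ 0ℤ
    a0-0c≡0 = solve-∀

  det-≈0ˡ : (u : Pair m) (v : Pair l) → num u ≈ 0ℤ [mod d ] → den u ≈ 0ℤ [mod d ] → det u v ≈ 0ℤ [mod d ]
  det-≈0ˡ {d = d} u v a≈0 b≈0 = subst (det u v ≈_[mod d ]) (0d-0c≡0 (den v) (num v))
    (−-cong-≈ (*-cong-≈ a≈0 (≈-refl {x = den v})) (*-cong-≈ b≈0 (≈-refl {x = num v})))

  det-≈0ʳ : (u : Pair m) (v : Pair l) → num v ≈ 0ℤ [mod d ] → den v ≈ 0ℤ [mod d ] → det u v ≈ 0ℤ [mod d ]
  det-≈0ʳ {d = d} u v c≈0 d≈0 = subst (det u v ≈_[mod d ]) (a0-b0≡0 (num u) (den u))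
    (−-cong-≈ (*-cong-≈ (≈-refl {x = num u}) d≈0) (*-cong-≈ (≈-refl {x = den u}) c≈0))

  det-≈0-den : (u : Pair m) (v : Pair l) → den u ≈ 0ℤ [mod d ] → den v ≈ 0ℤ [mod d ] → det u v ≈ 0ℤ [mod d ]
  det-≈0-den {d = d} u v b≈0 d≈0 = subst (det u v ≈_[mod d ]) (a0-0c≡0 (num u) (num v))
    (−-cong-≈ (*-cong-≈ (≈-refl {x = num u}) d≈0) (*-cong-≈ b≈0 (≈-refl {x = num v})))

  private
    gcd-divisors : ∀ a b n → let g = gcd (gcd a b) n in g ℕ∣.∣ a × g ℕ∣.∣ b × g ℕ∣.∣ n
    gcd-divisors a b n =
      ℕ∣.∣-trans g∣gcd[a,b] (gcd[m,n]∣m a b) , ℕ∣.∣-trans g∣gcd[a,b] (gcd[m,n]∣n a b) , gcd[m,n]∣n (gcd a b) n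
      where g∣gcd[a,b] = gcd[m,n]∣m (gcd a b) n

    det≈0⇒≡1 : {u v : Pair n} → Edge n u v → det u v ≈ 0ℤ [mod d ] → d ℕ∣.∣ n → d ≡ 1
    det≈0⇒≡1 e det≈0 d∣n =
      ℕ∣.∣1⇒≡1 (≈⇒≡mod (≈-trans (≈-sym (≈-weaken d∣n (≡mod⇒≈ e))) det≈0))

  edge⇒vertexˡ : (u v : Pair n) → Edge n u v → IsVertex n u
  edge⇒vertexˡ {n} (a , b) v e with gcd-divisors (toℕ a) (toℕ b) n
  ... | g∣a , g∣b , g∣n = det≈0⇒≡1 {u = a , b} {v} e (det-≈0ˡ (a , b) v (∣⇒≈0 g∣a) (∣⇒≈0 g∣b)) g∣n

  edge⇒vertexʳ : (u v : Pair n) → Edge n u v → IsVertex n v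
  edge⇒vertexʳ {n} u (c , d) e with gcd-divisors (toℕ c) (toℕ d) n
  ... | g∣c , g∣d , g∣n = det≈0⇒≡1 {u = u} {c , d} e (det-≈0ʳ u (c , d) (∣⇒≈0 g∣c) (∣⇒≈0 g∣d)) g∣n

  Edges : ∀ {L n} → Vec (Pair L) (suc n) → Set
  Edges {L} {n} w = ∀ (i : Fin n) → Edge L (lookup w (inject₁ i)) (lookup w (suc i))

  edges⇒vertices : ∀ {L n} (w : Vec (Pair L) (suc (suc n))) → Edges w → ∀ j → IsVertex L (lookup w j)
  edges⇒vertices w e zero    = edge⇒vertexˡ (lookup w zero) (lookup w (suc zero)) (e zero)
  edges⇒vertices w e (suc j) = edge⇒vertexʳ (lookup w (inject₁ j)) (lookup w (suc j)) (e j)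

  reducePair : (n : ℕ) .{{_ : ℕ.NonZero n}} → Pair m → Pair n
  reducePair n (a , b) = residue (+ toℕ a) n , residue (+ toℕ b) n

  reducePair-≈ᴾ : ∀ n .{{_ : ℕ.NonZero n}} (x : Pair m) → reducePair n x ≈ᴾ x [mod n ]
  reducePair-≈ᴾ n (a , b) = residue-≈ (+ toℕ a) n , residue-≈ (+ toℕ b) n

  ≈ᴾ⇒≡ : {x y : Pair n} → x ≈ᴾ y [mod n ] → x ≡ y
  ≈ᴾ⇒≡ {x = a , b} {c , d} (a≈c , b≈d) = cong₂ _,_ (≈-toℕ-injective a c a≈c) (≈-toℕ-injective b d b≈d)

  1/0 : 1 ℕ.< n → Pair n
  1/0 1<n = Fin.fromℕ< 1<n , Fin.fromℕ< (ℕP.m<n⇒0<n 1<n)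

  num-1/0 : (1<n : 1 ℕ.< n) → num (1/0 1<n) ≡ 1ℤ
  num-1/0 1<n = cong +_ (FinP.toℕ-fromℕ< 1<n)

  den-1/0 : (1<n : 1 ℕ.< n) → den (1/0 1<n) ≡ 0ℤ
  den-1/0 1<n = cong +_ (FinP.toℕ-fromℕ< (ℕP.m<n⇒0<n 1<n))

  1/0-≈ᴾ : ∀ {m} (1<n : 1 ℕ.< n) (x : Pair m) → num x ≈ 1ℤ [mod d ] → den x ≈ 0ℤ [mod d ] →
           1/0 1<n ≈ᴾ x [mod d ]
  1/0-≈ᴾ 1<n x a≈1 b≈0 =
    ≈-trans (≈-reflexive (num-1/0 1<n)) (≈-sym a≈1) , ≈-trans (≈-reflexive (den-1/0 1<n)) (≈-sym b≈0)

  VEq-1/0⇔ : (1<n : 1 ℕ.< n) (x : Pair n) → VEq n x 1ℤ (+ 0) ⇔ x ≡ 1/0 1<n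
  VEq-1/0⇔ 1<n x = mk⇔ (λ (a≡1 , b≡0) → sym (≈ᴾ⇒≡ (1/0-≈ᴾ 1<n x (≡mod⇒≈ a≡1) (≡mod⇒≈ b≡0))))
                       (λ { refl → ≈⇒≡mod (≈-reflexive (num-1/0 1<n)) , ≈⇒≡mod (≈-reflexive (den-1/0 1<n)) })

  reducePair-1/0 : ∀ .{{_ : ℕ.NonZero n}} (1<m : 1 ℕ.< m) (1<n : 1 ℕ.< n) → reducePair n (1/0 1<m) ≡ 1/0 1<n
  reducePair-1/0 {n} 1<m 1<n = ≈ᴾ⇒≡ (≈ᴾ-trans (reducePair-≈ᴾ n (1/0 1<m))
    (≈ᴾ-sym (1/0-≈ᴾ 1<n (1/0 1<m) (≈-reflexive (num-1/0 1<m)) (≈-reflexive (den-1/0 1<m)))))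

  edge-reduce : ∀ .{{_ : ℕ.NonZero d}} → d ℕ∣.∣ n → (u v : Pair n) → Edge n u v →
                Edge d (reducePair d u) (reducePair d v)
  edge-reduce {d} d∣n u v e =
    ≈⇒≡mod (≈-trans (det-cong (reducePair-≈ᴾ d u) (reducePair-≈ᴾ d v)) (≈-weaken d∣n (≡mod⇒≈ e)))

-- Counting walks

module Walks {A : Set} (xs : List A) {E : A → A → Set} (E? : ∀ u v → Dec (E u v))
             {F : A → Set} (F? : Decidable F) where
  open import Data.Nat using (_*_)
  open import Data.Fin using (inject₁; fromℕ)
  open import Data.Vec using (lookup)

  -- C j constrains the vertex at position j, the start u being at position 0.
  Walk : (C : ℕ → A → Set) → A → ∀ {n} → Vec A n → Set
  Walk C u []       = F u
  Walk C u (x ∷ ws) = E u x × C 1 x × Walk (C ∘ suc) x ws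

  walk? : ∀ {C : ℕ → A → Set} (C? : ∀ j → Decidable (C j)) u {n} (ws : Vec A n) → Dec (Walk C u ws)
  walk? C? u []       = F? u
  walk? C? u (x ∷ ws) = E? u x ×-dec C? 1 x ×-dec walk? (C? ∘ suc) x ws

  IsWalk : (C : ℕ → A → Set) → ∀ n → Vec A (suc n) → Set
  IsWalk C n w = (∀ (i : Fin n) → E (lookup w (inject₁ i)) (lookup w (suc i)))
               × (∀ (j : Fin (suc n)) → C (toℕ j) (lookup w j))
               × F (lookup w (fromℕ n))

  isWalk⇔walk : ∀ {C : ℕ → A → Set} n x (ws : Vec A n) → IsWalk C n (x ∷ ws) ⇔ (C 0 x × Walk C x ws)
  isWalk⇔walk n x ws = mk⇔ (to n x ws) (from n x ws)
    where
    to : ∀ {C : ℕ → A → Set} n x (ws : Vec A n) → IsWalk C n (x ∷ ws) → C 0 x × Walk C x ws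
    to zero    x []       (_ , c , f) = c zero , f
    to (suc n) x (y ∷ ws) (e , c , f) =
      c zero , e zero , to n y ws ((λ i → e (suc i)) , (λ j → c (suc j)) , f)

    from : ∀ {C : ℕ → A → Set} n x (ws : Vec A n) → C 0 x × Walk C x ws → IsWalk C n (x ∷ ws)
    from zero    x []       (c₀ , f)           = (λ ()) , (λ { zero → c₀ }) , f
    from (suc n) x (y ∷ ws) (c₀ , e₀ , c₁ , w) with from n y ws (c₁ , w)
    ... | e , c , f = (λ { zero → e₀ ; (suc i) → e i }) , (λ { zero → c₀ ; (suc j) → c j }) , f

  walks : ∀ {C : ℕ → A → Set} (C? : ∀ j → Decidable (C j)) → ℕ → A → ℕ
  walks C? zero    u = 𝟙 (F? u)
  walks C? (suc n) u = ∑[ x ∈ xs ] 𝟙 (E? u x) * (𝟙 (C? 1 x) * walks (C? ∘ suc) n x)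

  ∑-walk≡walks : ∀ {C : ℕ → A → Set} (C? : ∀ j → Decidable (C j)) n u →
                 ∑[ ws ∈ allVecs n xs ] 𝟙 (walk? C? u ws) ≡ walks C? n u
  ∑-walk≡walks C? zero    u = ℕP.+-identityʳ _
  ∑-walk≡walks C? (suc n) u = begin
    ∑[ ws ∈ allVecs (suc n) xs ] 𝟙 (walk? C? u ws)
      ≡⟨ sumOver-allVecs n xs _ ⟩
    ∑[ x ∈ xs ] ∑[ ws ∈ allVecs n xs ] 𝟙 (walk? C? u (x ∷ ws))
      ≡⟨ sumOver-cong xs (λ x → sumOver-cong (allVecs n xs) (λ ws → 𝟙-walk-∷ x ws)) ⟩
    ∑[ x ∈ xs ] ∑[ ws ∈ allVecs n xs ] 𝟙 (E? u x) * (𝟙 (C? 1 x) * 𝟙 (walk? (C? ∘ suc) x ws))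
      ≡⟨ sumOver-cong xs factor-out ⟩
    walks C? (suc n) u ∎
    where
    open ≡-Reasoning
    factor-out : ∀ x → ∑[ ws ∈ allVecs n xs ] 𝟙 (E? u x) * (𝟙 (C? 1 x) * 𝟙 (walk? (C? ∘ suc) x ws))
                       ≡ 𝟙 (E? u x) * (𝟙 (C? 1 x) * walks (C? ∘ suc) n x)
    factor-out x = begin
      ∑[ ws ∈ allVecs n xs ] 𝟙 (E? u x) * (𝟙 (C? 1 x) * 𝟙 (walk? (C? ∘ suc) x ws))
        ≡⟨ *-distribˡ-sumOver (𝟙 (E? u x)) (allVecs n xs) _ ⟨
      𝟙 (E? u x) * (∑[ ws ∈ allVecs n xs ] 𝟙 (C? 1 x) * 𝟙 (walk? (C? ∘ suc) x ws))
        ≡⟨ cong (𝟙 (E? u x) *_) (*-distribˡ-sumOver (𝟙 (C? 1 x)) (allVecs n xs) _) ⟨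
      𝟙 (E? u x) * (𝟙 (C? 1 x) * (∑[ ws ∈ allVecs n xs ] 𝟙 (walk? (C? ∘ suc) x ws)))
        ≡⟨ cong (λ k → 𝟙 (E? u x) * (𝟙 (C? 1 x) * k)) (∑-walk≡walks (C? ∘ suc) n x) ⟩
      𝟙 (E? u x) * (𝟙 (C? 1 x) * walks (C? ∘ suc) n x) ∎
    𝟙-walk-∷ : ∀ x {m} (ws : Vec A m) →
               𝟙 (walk? C? u (x ∷ ws)) ≡ 𝟙 (E? u x) * (𝟙 (C? 1 x) * 𝟙 (walk? (C? ∘ suc) x ws))
    𝟙-walk-∷ x ws = trans (𝟙-× (E? u x) _) (cong (𝟙 (E? u x) *_) (𝟙-× (C? 1 x) _))

-- Lifting from modulus N to modulus pN

module _ {m N : ℕ} .{{_ : ℕ.NonZero N}} where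
  open import Data.Nat using (_*_)

  -- The pair (y + N s)/(y′ + N s′).
  lift : Fin m → Fin m → Pair N → Pair (m * N)
  lift s s′ (y , y′) = combine s y , combine s′ y′

  lift-≈ᴾ : ∀ s s′ y → lift s s′ y ≈ᴾ y [mod N ]
  lift-≈ᴾ s s′ (y , y′) = ≈-combine s y , ≈-combine s′ y′
    where
    ≈-combine : ∀ s y → ℤ.+ toℕ (combine s y) ≈ ℤ.+ toℕ y [mod N ]
    ≈-combine s y =
      subst (λ c → ℤ.+ c ≈ ℤ.+ toℕ y [mod N ]) (sym (FinP.toℕ-combine s y)) (+[n*q+r]≈+r N (toℕ s) (toℕ y))

  reducePair-lift : ∀ s s′ y → reducePair N (lift s s′ y) ≡ y
  reducePair-lift s s′ y = ≈ᴾ⇒≡ (≈ᴾ-trans (reducePair-≈ᴾ N (lift s s′ y)) (lift-≈ᴾ s s′ y))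

  sumOver-allPairs-lift : ∀ f →
    ∑[ x ∈ allPairs (m * N) ] f x ≡ ∑[ y ∈ allPairs N ] ∑[ s < m ] ∑[ s′ < m ] f (lift s s′ y)
  sumOver-allPairs-lift f = begin
    ∑[ x ∈ allPairs (m * N) ] f x
      ≡⟨ sumOver-allPairs (m * N) f ⟩
    ∑[ a < m * N ] ∑[ b < m * N ] f (a , b)
      ≡⟨ sum-cong-≗ (λ a → ∑-combine m N (λ b → f (a , b))) ⟩
    ∑[ a < m * N ] ∑[ s′ < m ] ∑[ y′ < N ] f (a , combine s′ y′)
      ≡⟨ ∑-combine m N (λ a → ∑[ s′ < m ] ∑[ y′ < N ] f (a , combine s′ y′)) ⟩
    ∑[ s < m ] ∑[ y < N ] ∑[ s′ < m ] ∑[ y′ < N ] g s y s′ y′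
      ≡⟨ ∑-comm (λ s y → ∑[ s′ < m ] ∑[ y′ < N ] g s y s′ y′) ⟩
    ∑[ y < N ] ∑[ s < m ] ∑[ s′ < m ] ∑[ y′ < N ] g s y s′ y′
      ≡⟨ sum-cong-≗ (λ y → sum-cong-≗ (λ s → ∑-comm (λ s′ y′ → g s y s′ y′))) ⟩
    ∑[ y < N ] ∑[ s < m ] ∑[ y′ < N ] ∑[ s′ < m ] g s y s′ y′
      ≡⟨ sum-cong-≗ (λ y → ∑-comm (λ s y′ → ∑[ s′ < m ] g s y s′ y′)) ⟩
    ∑[ y < N ] ∑[ y′ < N ] ∑[ s < m ] ∑[ s′ < m ] g s y s′ y′
      ≡⟨ sumOver-allPairs N (λ y → ∑[ s < m ] ∑[ s′ < m ] f (lift s s′ y)) ⟨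
    ∑[ y ∈ allPairs N ] ∑[ s < m ] ∑[ s′ < m ] f (lift s s′ y) ∎
    where
    open ≡-Reasoning
    g : Fin m → Fin N → Fin m → Fin N → ℕ
    g s y s′ y′ = f (combine s y , combine s′ y′)

module Lifting {p N : ℕ} (p-prime : Prime p) .{{_ : ℕ.NonZero N}} (p∣N : p ℕ∣.∣ N) where
  open import Data.Integer using (ℤ; +_; _+_; _-_; _*_; -_; 0ℤ; 1ℤ)
  open import Data.Integer.Tactic.RingSolver using (solve-∀)
  import Function.Properties.Equivalence as ⇔

  private
    instance
      p≢0 : ℕ.NonZero p
      p≢0 = prime⇒nonZero p-prime

  reduce : Pair (p ℕ.* N) → Pair N
  reduce = reducePair N

  χ : Pair (p ℕ.* N) → Pair N → Fin p → Fin p → ℕ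
  χ u y s s′ = 𝟙 (edge? (p ℕ.* N) u (lift s s′ y))

  edge-lift⇒edge : ∀ u y (s s′ : Fin p) → Edge (p ℕ.* N) u (lift s s′ y) → Edge N (reduce u) y
  edge-lift⇒edge u y s s′ e =
    subst (Edge N (reduce u)) (reducePair-lift s s′ y) (edge-reduce (ℕ∣.n∣m*n p) u (lift s s′ y) e)

  module _ (u : Pair (p ℕ.* N)) (y : Pair N) (u→y : Edge N (reduce u) y) where

    -- Opaque: unfolding this proof term (whose quotient is e) makes type checking very slow.
    opaque
      det≈1 : det u y ≈ 1ℤ [mod N ]
      det≈1 = ≈-trans (det-cong (≈ᴾ-sym (reducePair-≈ᴾ N u)) ≈ᴾ-refl) (≡mod⇒≈ u→y)

    e : ℤ
    e = ℤ∣._∣_.quotient (_≈_[mod_].divides det≈1)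

    linear-form : Fin p → Fin p → ℤ
    linear-form s s′ = num u * + toℕ s′ - den u * + toℕ s + e

    private
      pos-combine : ∀ (s : Fin p) (y : Fin N) → + toℕ (combine s y) ≡ + N * + toℕ s + + toℕ y
      pos-combine s y = trans (cong +_ (FinP.toℕ-combine s y))
                              (trans (ℤP.pos-+ (N ℕ.* toℕ s) (toℕ y)) (cong (_+ + toℕ y) (ℤP.pos-* N (toℕ s))))

      expand : ∀ a b c d n σ σ′ →
               a * (n * σ′ + d) - b * (n * σ + c) - 1ℤ ≡ n * (a * σ′ - b * σ) + (a * d - b * c - 1ℤ)
      expand = solve-∀

      collect : ∀ z e n → n * z + e * n ≡ n * (z + e)
      collect = solve-∀

    det-lift : ∀ (s s′ : Fin p) → det u (lift s s′ y) - 1ℤ ≡ + N * linear-form s s′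
    det-lift s s′ = begin
      num u * + toℕ (combine s′ (proj₂ y)) - den u * + toℕ (combine s (proj₁ y)) - 1ℤ
        ≡⟨ cong₂ (λ c c′ → num u * c′ - den u * c - 1ℤ) (pos-combine s (proj₁ y)) (pos-combine s′ (proj₂ y)) ⟩
      num u * (+ N * + toℕ s′ + den y) - den u * (+ N * + toℕ s + num y) - 1ℤ
        ≡⟨ expand (num u) (den u) (num y) (den y) (+ N) (+ toℕ s) (+ toℕ s′) ⟩
      + N * z + (det u y - 1ℤ)
        ≡⟨ cong (λ d → + N * z + d) (ℤ∣._∣_.equality (_≈_[mod_].divides det≈1)) ⟩
      + N * z + e * + N
        ≡⟨ collect z e (+ N) ⟩
      + N * linear-form s s′ ∎
      where
      open ≡-Reasoning
      z = num u * + toℕ s′ - den u * + toℕ s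

    edge-lift⇔ : ∀ (s s′ : Fin p) → Edge (p ℕ.* N) u (lift s s′ y) ⇔ (linear-form s s′ ≈ 0ℤ [mod p ])
    edge-lift⇔ s s′ =
      ⇔.trans (edge⇔det≈1 {u = u} {lift s s′ y})
        (⇔.trans (⇔.sym −≈0⇔≈)
          (subst (λ z → (z ≈ 0ℤ [mod p ℕ.* N ]) ⇔ (linear-form s s′ ≈ 0ℤ [mod p ]))
                 (sym (det-lift s s′)) (*-cancel-≈0 p N)))

    det≉0 : ¬ det u y ≈ 0ℤ [mod p ]
    det≉0 det≈0 =
      ¬1≈0 (ℕ.nonTrivial⇒n>1 p {{prime⇒nonTrivial p-prime}}) (≈-trans (≈-sym (≈-weaken p∣N det≈1)) det≈0)

    private
      a[s′]-b[s]+e≡[a[s′]+e]+[-b][s] : ∀ a b e s s′ → a * s′ - b * s + e ≡ (a * s′ + e) + - b * s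
      a[s′]-b[s]+e≡[a[s′]+e]+[-b][s] = solve-∀

      a[s′]-b[s]+e≡[e-b[s]]+a[s′] : ∀ a b e s s′ → a * s′ - b * s + e ≡ (e - b * s) + a * s′
      a[s′]-b[s]+e≡[e-b[s]]+a[s′] = solve-∀

      -x≈0⇒x≈0 : ∀ {x} → - x ≈ 0ℤ [mod p ] → x ≈ 0ℤ [mod p ]
      -x≈0⇒x≈0 {x} -x≈0 = subst₂ (_≈_[mod p ]) (ℤP.neg-involutive x) refl (neg-cong-≈ -x≈0)

    ∑-χ-unique-s : ¬ den u ≈ 0ℤ [mod p ] → ∀ s′ → ∑[ s < p ] χ u y s s′ ≡ 1
    ∑-χ-unique-s b≉0 s′ = trans
      (sum-cong-≗ λ s → 𝟙-cong (edge? (p ℕ.* N) u (lift s s′ y)) (_ ≈? 0ℤ [mod p ])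
        (subst (λ z → _ ⇔ (z ≈ 0ℤ [mod p ]))
               (a[s′]-b[s]+e≡[a[s′]+e]+[-b][s] (num u) (den u) e (+ toℕ s) (+ toℕ s′)) (edge-lift⇔ s s′)))
      (∑-𝟙-linear-root p-prime (num u * + toℕ s′ + e) (b≉0 ∘ -x≈0⇒x≈0))

    ∑-χ-unique-s′ : ¬ num u ≈ 0ℤ [mod p ] → ∀ s → ∑[ s′ < p ] χ u y s s′ ≡ 1
    ∑-χ-unique-s′ a≉0 s = trans
      (sum-cong-≗ λ s′ → 𝟙-cong (edge? (p ℕ.* N) u (lift s s′ y)) (_ ≈? 0ℤ [mod p ])
        (subst (λ z → _ ⇔ (z ≈ 0ℤ [mod p ]))
               (a[s′]-b[s]+e≡[e-b[s]]+a[s′] (num u) (den u) e (+ toℕ s) (+ toℕ s′)) (edge-lift⇔ s s′)))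
      (∑-𝟙-linear-root p-prime (e - den u * + toℕ s) a≉0)

  ∑∑-χ : ∀ u y → ∑[ s < p ] ∑[ s′ < p ] χ u y s s′ ≡ p ℕ.* 𝟙 (edge? N (reduce u) y)
  ∑∑-χ u y with edge? N (reduce u) y
  ... | no ¬u→y =
    trans (∑-zero p λ s → ∑-zero p λ s′ → χ≡0 s s′) (sym (ℕP.*-zeroʳ p))
    where
    χ≡0 : ∀ s s′ → χ u y s s′ ≡ 0
    χ≡0 s s′ = 𝟙-≡0 (edge? (p ℕ.* N) u (lift s s′ y)) (¬u→y ∘ edge-lift⇒edge u y s s′)
  ... | yes u→y with den u ≈? 0ℤ [mod p ]
  ...   | no b≉0  = trans (∑-comm (χ u y)) (trans (sum-cong-≗ (∑-χ-unique-s u y u→y b≉0)) (∑-const p 1))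
  ...   | yes b≈0 = trans (sum-cong-≗ (∑-χ-unique-s′ u y u→y a≉0)) (∑-const p 1)
    where
    a≉0 : ¬ num u ≈ 0ℤ [mod p ]
    a≉0 a≈0 = det≉0 u y u→y (det-≈0ˡ u y a≈0 b≈0)

  nonzero : Fin p → ℕ
  nonzero s′ = 𝟙 (¬? (toℕ s′ ℕ.≟ 0))

  ∑∑-χ-nonzero : ∀ u y → toℕ (proj₂ y) ≡ 0 →
    ∑[ s < p ] ∑[ s′ < p ] (χ u y s s′ ℕ.* nonzero s′) ≡ (p ℕ.∸ 1) ℕ.* 𝟙 (edge? N (reduce u) y)
  ∑∑-χ-nonzero u y y′≡0 with edge? N (reduce u) y
  ... | no ¬u→y = trans (∑-zero p λ s → ∑-zero p λ s′ → cong (ℕ._* nonzero s′) (χ≡0 s s′)) (sym (ℕP.*-zeroʳ (p ℕ.∸ 1)))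
    where
    χ≡0 : ∀ s s′ → χ u y s s′ ≡ 0
    χ≡0 s s′ = 𝟙-≡0 (edge? (p ℕ.* N) u (lift s s′ y)) (¬u→y ∘ edge-lift⇒edge u y s s′)
  ... | yes u→y = begin
    ∑[ s < p ] ∑[ s′ < p ] (χ u y s s′ ℕ.* nonzero s′)
      ≡⟨ ∑-comm (λ s s′ → χ u y s s′ ℕ.* nonzero s′) ⟩
    ∑[ s′ < p ] ∑[ s < p ] (χ u y s s′ ℕ.* nonzero s′)
      ≡⟨ sum-cong-≗ (λ s′ → *-distribʳ-sum (nonzero s′) (λ s → χ u y s s′)) ⟨
    ∑[ s′ < p ] ((∑[ s < p ] χ u y s s′) ℕ.* nonzero s′)
      ≡⟨ sum-cong-≗ (λ s′ → cong (ℕ._* nonzero s′) (∑-χ-unique-s u y u→y b≉0 s′)) ⟩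
    ∑[ s′ < p ] (1 ℕ.* nonzero s′)
      ≡⟨ sum-cong-≗ (λ s′ → ℕP.*-identityˡ (nonzero s′)) ⟩
    ∑[ s′ < p ] nonzero s′
      ≡⟨ ∑-𝟙-nonzero p ⟩
    p ℕ.∸ 1
      ≡⟨ ℕP.*-identityʳ (p ℕ.∸ 1) ⟨
    (p ℕ.∸ 1) ℕ.* 1 ∎
    where
    open ≡-Reasoning
    b≉0 : ¬ den u ≈ 0ℤ [mod p ]
    b≉0 b≈0 = det≉0 u y u→y (det-≈0-den u y b≈0 (≈-reflexive (cong +_ y′≡0)))

module WalkLifting {p N : ℕ} (p-prime : Prime p) .{{_ : ℕ.NonZero N}} (p∣N : p ℕ∣.∣ N) where
  open import Data.Nat using (_+_; _*_; _∸_; _^_)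
  open import Data.Nat.Tactic.RingSolver using (solve-∀)
  import Function.Properties.Equivalence as ⇔
  open Lifting p-prime p∣N

  ∑∑-χ-reduce : ∀ u y (H : Pair N → ℕ) →
    ∑[ s < p ] ∑[ s′ < p ] (χ u y s s′ * H (reduce (lift s s′ y))) ≡ p * (𝟙 (edge? N (reduce u) y) * H y)
  ∑∑-χ-reduce u y H = begin
    ∑[ s < p ] ∑[ s′ < p ] (χ u y s s′ * H (reduce (lift s s′ y)))
      ≡⟨ ∑∑-cong (λ s s′ → cong (λ z → χ u y s s′ * H z) (reducePair-lift s s′ y)) ⟩
    ∑[ s < p ] ∑[ s′ < p ] (χ u y s s′ * H y)
      ≡⟨ sum-cong-≗ (λ s → *-distribʳ-sum (H y) (χ u y s)) ⟨
    ∑[ s < p ] ((∑[ s′ < p ] χ u y s s′) * H y)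
      ≡⟨ *-distribʳ-sum (H y) (λ s → ∑[ s′ < p ] χ u y s s′) ⟨
    (∑[ s < p ] ∑[ s′ < p ] χ u y s s′) * H y
      ≡⟨ cong (_* H y) (∑∑-χ u y) ⟩
    p * 𝟙 (edge? N (reduce u) y) * H y
      ≡⟨ ℕP.*-assoc p _ (H y) ⟩
    p * (𝟙 (edge? N (reduce u) y) * H y) ∎
    where open ≡-Reasoning

  ∑∑-χ-end : ∀ u y c {D : Set} (D? : Dec D) → (D → toℕ (proj₂ y) ≡ 0) →
    ∑[ s < p ] ∑[ s′ < p ] (χ u y s s′ * (c * (𝟙 D? * nonzero s′))) ≡ (p ∸ 1) * (𝟙 (edge? N (reduce u) y) * (c * 𝟙 D?))
  ∑∑-χ-end u y c (no _) _ =
    trans (∑-zero p λ s → ∑-zero p λ s′ → e*[c*0]≡0 (χ u y s s′) c) (sym (k*[e*[c*0]]≡0 (p ∸ 1) (𝟙 (edge? N (reduce u) y)) c))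
    where
    e*[c*0]≡0 : ∀ e c → e * (c * 0) ≡ 0
    e*[c*0]≡0 = solve-∀
    k*[e*[c*0]]≡0 : ∀ k e c → k * (e * (c * 0)) ≡ 0
    k*[e*[c*0]]≡0 = solve-∀
  ∑∑-χ-end u y c (yes d) d⇒y′≡0 = begin
    ∑[ s < p ] ∑[ s′ < p ] (χ u y s s′ * (c * (1 * nonzero s′)))
      ≡⟨ ∑∑-cong (λ s s′ → rearrange (χ u y s s′) c (nonzero s′)) ⟩
    ∑[ s < p ] ∑[ s′ < p ] (c * (χ u y s s′ * nonzero s′))
      ≡⟨ *-distribˡ-∑∑ c (λ s s′ → χ u y s s′ * nonzero s′) ⟨
    c * (∑[ s < p ] ∑[ s′ < p ] (χ u y s s′ * nonzero s′))
      ≡⟨ cong (c *_) (∑∑-χ-nonzero u y (d⇒y′≡0 d)) ⟩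
    c * ((p ∸ 1) * 𝟙 (edge? N (reduce u) y))
      ≡⟨ finish c (p ∸ 1) _ ⟩
    (p ∸ 1) * (𝟙 (edge? N (reduce u) y) * (c * 1)) ∎
    where
    open ≡-Reasoning
    rearrange : ∀ e c w → e * (c * (1 * w)) ≡ c * (e * w)
    rearrange = solve-∀
    finish : ∀ c k e → c * (k * e) ≡ k * (e * (c * 1))
    finish = solve-∀

  ∑-edge-reduce : ∀ u (H : Pair N → ℕ) →
    ∑[ x ∈ allPairs (p * N) ] 𝟙 (edge? (p * N) u x) * H (reduce x) ≡ p * (∑[ y ∈ allPairs N ] 𝟙 (edge? N (reduce u) y) * H y)
  ∑-edge-reduce u H = begin
    ∑[ x ∈ allPairs (p * N) ] 𝟙 (edge? (p * N) u x) * H (reduce x)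
      ≡⟨ sumOver-allPairs-lift {p} (λ x → 𝟙 (edge? (p * N) u x) * H (reduce x)) ⟩
    ∑[ y ∈ allPairs N ] ∑[ s < p ] ∑[ s′ < p ] (χ u y s s′ * H (reduce (lift s s′ y)))
      ≡⟨ sumOver-cong (allPairs N) (λ y → ∑∑-χ-reduce u y H) ⟩
    ∑[ y ∈ allPairs N ] p * (𝟙 (edge? N (reduce u) y) * H y)
      ≡⟨ *-distribˡ-sumOver p (allPairs N) _ ⟨
    p * (∑[ y ∈ allPairs N ] 𝟙 (edge? N (reduce u) y) * H y) ∎
    where open ≡-Reasoning

  module _ {F̃ : Pair (p * N) → Set} (F̃? : Decidable F̃) {F : Pair N → Set} (F? : Decidable F) where
    private
      module W̃ = Walks (allPairs (p * N)) (edge? (p * N)) F̃?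
      module W = Walks (allPairs N) (edge? N) F?

    Compatible : (ℕ → Pair (p * N) → Set) → (ℕ → Pair N → Set) → Set
    Compatible C̃ C = ∀ j x → C̃ j x ⇔ C j (reduce x)

    LiftsWith : ℕ → ℕ → Set₁
    LiftsWith n c = ∀ {C̃ : ℕ → Pair (p * N) → Set} {C : ℕ → Pair N → Set}
                      (C̃? : ∀ j → Decidable (C̃ j)) (C? : ∀ j → Decidable (C j)) → Compatible C̃ C →
                      ∀ u → W̃.walks C̃? n u ≡ c * W.walks C? n (reduce u)

    walks-lift : ∀ {n₀ c} → LiftsWith n₀ c → ∀ m → LiftsWith (m + n₀) (p ^ m * c)
    walks-lift {c = c} base zero C̃? C? compat u =
      trans (base C̃? C? compat u) (cong (_* _) (sym (ℕP.+-identityʳ c)))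
    walks-lift {n₀} {c} base (suc m) {C̃} {C} C̃? C? compat u = begin
      ∑[ x ∈ allPairs (p * N) ] 𝟙 (edge? (p * N) u x) * (𝟙 (C̃? 1 x) * W̃.walks (C̃? ∘ suc) (m + n₀) x)
        ≡⟨ sumOver-cong (allPairs (p * N)) (λ x → cong (𝟙 (edge? (p * N) u x) *_) (cong₂ _*_ (𝟙C̃≡𝟙C x) (ih x))) ⟩
      ∑[ x ∈ allPairs (p * N) ] 𝟙 (edge? (p * N) u x) * H (reduce x)
        ≡⟨ ∑-edge-reduce u H ⟩
      p * (∑[ y ∈ allPairs N ] 𝟙 (edge? N (reduce u) y) * H y)
        ≡⟨ cong (p *_) (sumOver-cong (allPairs N) (λ y → rearrange (𝟙 (edge? N (reduce u) y)) (𝟙 (C? 1 y)) (p ^ m * c) (W.walks (C? ∘ suc) (m + n₀) y))) ⟩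
      p * (∑[ y ∈ allPairs N ] p ^ m * c * (𝟙 (edge? N (reduce u) y) * (𝟙 (C? 1 y) * W.walks (C? ∘ suc) (m + n₀) y)))
        ≡⟨ cong (p *_) (*-distribˡ-sumOver (p ^ m * c) (allPairs N) _) ⟨
      p * (p ^ m * c * W.walks C? (suc m + n₀) (reduce u))
        ≡⟨ reassociate p (p ^ m) c _ ⟩
      p ^ suc m * c * W.walks C? (suc m + n₀) (reduce u) ∎
      where
      open ≡-Reasoning
      H : Pair N → ℕ
      H y = 𝟙 (C? 1 y) * (p ^ m * c * W.walks (C? ∘ suc) (m + n₀) y)
      𝟙C̃≡𝟙C : ∀ x → 𝟙 (C̃? 1 x) ≡ 𝟙 (C? 1 (reduce x))
      𝟙C̃≡𝟙C x = 𝟙-cong (C̃? 1 x) (C? 1 (reduce x)) (compat 1 x)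
      ih : ∀ x → W̃.walks (C̃? ∘ suc) (m + n₀) x ≡ p ^ m * c * W.walks (C? ∘ suc) (m + n₀) (reduce x)
      ih = walks-lift base m (C̃? ∘ suc) (C? ∘ suc) (compat ∘ suc)
      rearrange : ∀ e d k w → e * (d * (k * w)) ≡ k * (e * (d * w))
      rearrange = solve-∀
      reassociate : ∀ p q c w → p * (q * c * w) ≡ p * q * c * w
      reassociate = solve-∀

    walks-lift-base₀ : (∀ x → F̃ x ⇔ F (reduce x)) → LiftsWith 0 1
    walks-lift-base₀ F̃⇔F C̃? C? compat u = trans (𝟙-cong (F̃? u) (F? (reduce u)) (F̃⇔F u)) (sym (ℕP.*-identityˡ _))

    walks-lift-base₁ : (∀ (s s′ : Fin p) y → F̃ (lift s s′ y) ⇔ (F y × toℕ s′ ≢ 0)) →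
                       (∀ y → F y → toℕ (proj₂ y) ≡ 0) → LiftsWith 1 (p ∸ 1)
    walks-lift-base₁ F̃-lift⇔ F⇒y′≡0 {C̃} {C} C̃? C? compat u = begin
      ∑[ x ∈ allPairs (p * N) ] 𝟙 (edge? (p * N) u x) * (𝟙 (C̃? 1 x) * 𝟙 (F̃? x))
        ≡⟨ sumOver-allPairs-lift {p} (λ x → 𝟙 (edge? (p * N) u x) * (𝟙 (C̃? 1 x) * 𝟙 (F̃? x))) ⟩
      ∑[ y ∈ allPairs N ] ∑[ s < p ] ∑[ s′ < p ] (χ u y s s′ * (𝟙 (C̃? 1 (lift s s′ y)) * 𝟙 (F̃? (lift s s′ y))))
        ≡⟨ sumOver-cong (allPairs N) (λ y → ∑∑-cong (λ s s′ → cong (χ u y s s′ *_) (cong₂ _*_ (𝟙C̃≡𝟙C s s′ y) (𝟙F̃≡𝟙F*nonzero s s′ y)))) ⟩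
      ∑[ y ∈ allPairs N ] ∑[ s < p ] ∑[ s′ < p ] (χ u y s s′ * (𝟙 (C? 1 y) * (𝟙 (F? y) * nonzero s′)))
        ≡⟨ sumOver-cong (allPairs N) (λ y → ∑∑-χ-end u y (𝟙 (C? 1 y)) (F? y) (F⇒y′≡0 y)) ⟩
      ∑[ y ∈ allPairs N ] (p ∸ 1) * (𝟙 (edge? N (reduce u) y) * (𝟙 (C? 1 y) * 𝟙 (F? y)))
        ≡⟨ *-distribˡ-sumOver (p ∸ 1) (allPairs N) _ ⟨
      (p ∸ 1) * W.walks C? 1 (reduce u) ∎
      where
      open ≡-Reasoning
      𝟙C̃≡𝟙C : ∀ (s s′ : Fin p) y → 𝟙 (C̃? 1 (lift s s′ y)) ≡ 𝟙 (C? 1 y)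
      𝟙C̃≡𝟙C s s′ y = trans (𝟙-cong (C̃? 1 (lift s s′ y)) (C? 1 (reduce (lift s s′ y))) (compat 1 (lift s s′ y)))
                            (cong (𝟙 ∘ C? 1) (reducePair-lift s s′ y))
      𝟙F̃≡𝟙F*nonzero : ∀ (s s′ : Fin p) y → 𝟙 (F̃? (lift s s′ y)) ≡ 𝟙 (F? y) * nonzero s′
      𝟙F̃≡𝟙F*nonzero s s′ y = trans (𝟙-cong (F̃? (lift s s′ y)) (F? y ×-dec ¬? (toℕ s′ ℕ.≟ 0)) (F̃-lift⇔ s s′ y))
                              (𝟙-× (F? y) (¬? (toℕ s′ ℕ.≟ 0)))

    walks-lift₀ : (∀ x → F̃ x ⇔ F (reduce x)) → ∀ n → LiftsWith n (p ^ n)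
    walks-lift₀ F̃⇔F n =
      subst₂ LiftsWith (ℕP.+-identityʳ n) (ℕP.*-identityʳ (p ^ n)) (walks-lift (walks-lift-base₀ F̃⇔F) n)

    walks-lift₁ : (∀ (s s′ : Fin p) y → F̃ (lift s s′ y) ⇔ (F y × toℕ s′ ≢ 0)) →
                  (∀ y → F y → toℕ (proj₂ y) ≡ 0) → ∀ n → LiftsWith (suc n) (p ^ n * (p ∸ 1))
    walks-lift₁ F̃-lift⇔ F⇒y′≡0 n =
      subst (λ m → LiftsWith m (p ^ n * (p ∸ 1))) (ℕP.+-comm n 1) (walks-lift (walks-lift-base₁ F̃-lift⇔ F⇒y′≡0) n)

-- Lifts of paths in Ω_{2k}(p) and the sets Z_k(r), Z_k(r, t)

module ΩLifts {p : ℕ} (p-prime : Prime p) where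
  open import Data.Integer using (+_; 0ℤ; 1ℤ)
  open import Data.Nat using (_%_; _/_; _*_; _^_; _∸_)
  open import Data.Fin using (inject₁)
  open import Data.Vec as Vec using (lookup)
  import Data.Vec.Properties as VecP
  open import Data.List.Membership.Propositional using (lose)
  open import Data.List.Relation.Unary.Any using (satisfied)
  open import Relation.Nullary.Decidable using (_→-dec_)

  private
    instance
      p≢0 : ℕ.NonZero p
      p≢0 = prime⇒nonZero p-prime

  1<p^[1+n] : ∀ n → 1 ℕ.< p ^ suc n
  1<p^[1+n] n = ℕP.<-≤-trans (ℕ.nonTrivial⇒n>1 p {{prime⇒nonTrivial p-prime}}) (ℕP.m≤m*n p (p ^ n) {{ℕP.m^n≢0 p n}})

  ΩCondition : ∀ {L} → ℕ → Pair L → Set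
  ΩCondition j x = j % 2 ≡ 0 → num x ≈ -1ℤ ℤ.^ (j / 2) [mod p ] × den x ≈ 0ℤ [mod p ]

  ΩCondition? : ∀ {L} j → Decidable (ΩCondition {L} j)
  ΩCondition? j x = (j % 2 ℕ.≟ 0) →-dec ((num x ≈? -1ℤ ℤ.^ (j / 2) [mod p ]) ×-dec (den x ≈? 0ℤ [mod p ]))

  ΩCondition-≈ᴾ : ∀ {j m l} {x : Pair m} {y : Pair l} → x ≈ᴾ y [mod p ] → ΩCondition j x → ΩCondition j y
  ΩCondition-≈ᴾ (a≈c , b≈d) cond j-even =
    ≈-trans (≈-sym a≈c) (proj₁ (cond j-even)) , ≈-trans (≈-sym b≈d) (proj₂ (cond j-even))

  liftOfΩ⇔ : ∀ k r (w : Vec (Pair (p ^ suc r)) (suc (2 * suc k))) →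
             LiftOfΩ p (suc k) (suc r) w ⇔ (Edges w × ∀ j → ΩCondition (toℕ j) (lookup w j))
  liftOfΩ⇔ k r w = mk⇔ to from
    where
    p∣L = ℕ∣.m∣m*n (p ^ r)

    to : LiftOfΩ p (suc k) (suc r) w → Edges w × ∀ j → ΩCondition (toℕ j) (lookup w j)
    to (path , lift) = proj₂ path , condition
      where
      condition : ∀ j → ΩCondition (toℕ j) (lookup w j)
      condition j j-even with satisfied lift
      ... | v , ((_ , v-in-Ω) , w-reduces) with v-in-Ω j j-even | w-reduces j
      ... | vₙ≡σ , v_d≡0 | vₙ≡wₙ , v_d≡w_d =
        ≈-trans (≈-sym (≡mod⇒≈ vₙ≡wₙ)) (≡mod⇒≈ {x = num (lookup v j)} vₙ≡σ) ,
        ≈-trans (≈-sym (≡mod⇒≈ v_d≡w_d)) (≡mod⇒≈ {x = den (lookup v j)} v_d≡0)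

    from : Edges w × (∀ j → ΩCondition (toℕ j) (lookup w j)) → LiftOfΩ p (suc k) (suc r) w
    from (e , c) = (edges⇒vertices w e , e) , lose (∈-allVecs ∈-allPairs v) ((v-path , v-in-Ω) , w-reduces)
      where
      v = Vec.map (reducePair p) w
      v≈w : ∀ i → lookup v i ≈ᴾ lookup w i [mod p ]
      v≈w i = subst (_≈ᴾ lookup w i [mod p ]) (sym (VecP.lookup-map i (reducePair p) w)) (reducePair-≈ᴾ p (lookup w i))
      v-edges : Edges v
      v-edges i = ≈⇒≡mod (≈-trans (det-cong (v≈w (inject₁ i)) (v≈w (suc i))) (≈-weaken p∣L (≡mod⇒≈ (e i))))
      v-path : IsPath p (2 * suc k) v
      v-path = edges⇒vertices v v-edges , v-edges
      v-in-Ω : ∀ j → toℕ j % 2 ≡ 0 → VEq p (lookup v j) (-1ℤ ℤ.^ (toℕ j / 2)) (+ 0)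
      v-in-Ω j j-even = ≈⇒≡mod (≈-trans (proj₁ (v≈w j)) (proj₁ (c j j-even)))
                      , ≈⇒≡mod (≈-trans (proj₂ (v≈w j)) (proj₂ (c j j-even)))
      w-reduces : Reduces p (suc r) (suc (2 * suc k)) w v
      w-reduces i = ≈⇒≡mod (proj₁ (v≈w i)) , ≈⇒≡mod (proj₂ (v≈w i))

  module Counting (k r : ℕ) {F : Pair (p ^ suc r) → Set} (F? : Decidable F) where
    open Walks (allPairs (p ^ suc r)) (edge? (p ^ suc r)) F? public

    private
      L = p ^ suc r
      n = 2 * suc k
      1<L = 1<p^[1+n] r

    LiftStartEnd : Vec (Pair L) (suc n) → Set
    LiftStartEnd w = LiftOfΩ p (suc k) (suc r) w × VEq L (first {k = suc k} w) 1ℤ (+ 0) × F (last {k = suc k} w)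

    liftStartEnd⇔walk : ∀ x xs → LiftStartEnd (x ∷ xs) ⇔ (VEq L x 1ℤ (+ 0) × Walk ΩCondition x xs)
    liftStartEnd⇔walk x xs = mk⇔ to from
      where
      to : LiftStartEnd (x ∷ xs) → VEq L x 1ℤ (+ 0) × Walk ΩCondition x xs
      to (lift , start , end) = start , proj₂ (Equivalence.to (isWalk⇔walk n x xs) (proj₁ ec , proj₂ ec , end))
        where ec = Equivalence.to (liftOfΩ⇔ k r (x ∷ xs)) lift

      from : VEq L x 1ℤ (+ 0) × Walk ΩCondition x xs → LiftStartEnd (x ∷ xs)
      from ((a≡1 , b≡0) , walk) =
        Equivalence.from (liftOfΩ⇔ k r (x ∷ xs)) (proj₁ ecf , proj₁ (proj₂ ecf)) , (a≡1 , b≡0) , proj₂ (proj₂ ecf)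
        where
        p∣L = ℕ∣.m∣m*n (p ^ r)
        ecf = Equivalence.from (isWalk⇔walk n x xs) ((λ _ → ≈-weaken p∣L (≡mod⇒≈ a≡1) , ≈-weaken p∣L (≡mod⇒≈ b≡0)) , walk)

    count : (P? : Decidable LiftStartEnd) → length (filter P? (Seqs L (suc k))) ≡ walks ΩCondition? n (1/0 1<L)
    count P? = begin
      length (filter P? (allVecs (suc n) (allPairs L)))
        ≡⟨ length-filter≡∑𝟙 P? (allVecs (suc n) (allPairs L)) ⟩
      ∑[ w ∈ allVecs (suc n) (allPairs L) ] 𝟙 (P? w)
        ≡⟨ sumOver-allVecs n (allPairs L) (𝟙 ∘ P?) ⟩
      ∑[ x ∈ allPairs L ] ∑[ xs ∈ allVecs n (allPairs L) ] 𝟙 (P? (x ∷ xs))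
        ≡⟨ sumOver-cong (allPairs L) (λ x → sumOver-cong (allVecs n (allPairs L)) (𝟙-split x)) ⟩
      ∑[ x ∈ allPairs L ] ∑[ xs ∈ allVecs n (allPairs L) ] 𝟙 (start? x) * 𝟙 (walk? ΩCondition? x xs)
        ≡⟨ sumOver-cong (allPairs L) (λ x → *-distribˡ-sumOver (𝟙 (start? x)) (allVecs n (allPairs L)) _) ⟨
      ∑[ x ∈ allPairs L ] 𝟙 (start? x) * (∑[ xs ∈ allVecs n (allPairs L) ] 𝟙 (walk? ΩCondition? x xs))
        ≡⟨ sumOver-cong (allPairs L) (λ x → cong (𝟙 (start? x) *_) (∑-walk≡walks ΩCondition? n x)) ⟩
      ∑[ x ∈ allPairs L ] 𝟙 (start? x) * walks ΩCondition? n x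
        ≡⟨ sumOver-allPairs-single (1/0 1<L) (λ x → 𝟙 (start? x) * walks ΩCondition? n x) off-start ⟩
      𝟙 (start? (1/0 1<L)) * walks ΩCondition? n (1/0 1<L)
        ≡⟨ cong (_* walks ΩCondition? n (1/0 1<L)) (𝟙-≡1 (start? (1/0 1<L)) (Equivalence.from (VEq-1/0⇔ 1<L _) refl)) ⟩
      1 * walks ΩCondition? n (1/0 1<L)
        ≡⟨ ℕP.*-identityˡ _ ⟩
      walks ΩCondition? n (1/0 1<L) ∎
      where
      open ≡-Reasoning
      start? : ∀ x → Dec (VEq L x 1ℤ (+ 0))
      start? x = vEq? L x 1ℤ (+ 0)
      𝟙-split : ∀ x xs → 𝟙 (P? (x ∷ xs)) ≡ 𝟙 (start? x) * 𝟙 (walk? ΩCondition? x xs)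
      𝟙-split x xs = trans (𝟙-cong (P? (x ∷ xs)) (start? x ×-dec walk? ΩCondition? x xs) (liftStartEnd⇔walk x xs))
                           (𝟙-× (start? x) (walk? ΩCondition? x xs))
      off-start : ∀ x → x ≢ 1/0 1<L → 𝟙 (start? x) * walks ΩCondition? n x ≡ 0
      off-start x x≢1/0 = cong (_* walks ΩCondition? n x) (𝟙-≡0 (start? x) (x≢1/0 ∘ Equivalence.to (VEq-1/0⇔ 1<L x)))

  -- The conditions InZt puts on the final vertex, written exactly as there so that InZt unfolds to LiftStartEnd.
  ZtEnd : ∀ {L} → ℕ → ℕ → Pair L → Set
  ZtEnd k t x = (num x ≡ ε k [mod p ]) × (den x ≡ + 0 [mod p ]) × (p ^ t ℕ∣.∣ toℕ (proj₂ x))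
              × (¬ p ^ suc t ℕ∣.∣ toℕ (proj₂ x)) × (num x ≡ ε k [mod p ^ t ])

  ZtEnd? : ∀ {L} k t → Decidable (ZtEnd {L} k t)
  ZtEnd? k t x = (num x ≡? ε k [mod p ]) ×-dec (den x ≡? + 0 [mod p ]) ×-dec (p ^ t ℕ∣.∣? toℕ (proj₂ x))
               ×-dec ¬? (p ^ suc t ℕ∣.∣? toℕ (proj₂ x)) ×-dec (num x ≡? ε k [mod p ^ t ])

  ZEnd : ∀ {L} → ℕ → Pair L → Set
  ZEnd {L} k x = VEq L x (ε k) (+ 0)

  ZEnd? : ∀ {L} k → Decidable (ZEnd {L} k)
  ZEnd? {L} k x = vEq? L x (ε k) (+ 0)

  ZtEnd-≈ᴾ : ∀ {k t n m l} {x : Pair m} {y : Pair l} → p ^ suc t ℕ∣.∣ n → x ≈ᴾ y [mod n ] → ZtEnd k t x → ZtEnd k t y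
  ZtEnd-≈ᴾ {k} {t} {x = _ , b} {_ , d} p^[1+t]∣n (a≈c , b≈d) (a≡ε , b≡0 , p^t∣b , p^[1+t]∤b , a≡ε′) =
    ≡mod-resp-≈ {c = ε k} p∣n a≈c a≡ε , ≡mod-resp-≈ {c = + 0} p∣n b≈d b≡0 , ∣-resp-≈ p^t∣n b≈d p^t∣b ,
    p^[1+t]∤b ∘ ∣-resp-≈ p^[1+t]∣n (≈-sym b≈d) , ≡mod-resp-≈ {c = ε k} p^t∣n a≈c a≡ε′
    where
    p^t∣n = ℕ∣.∣-trans (ℕ∣.n∣m*n p) p^[1+t]∣n
    p∣n = ℕ∣.∣-trans (ℕ∣.m∣m*n (p ^ t)) p^[1+t]∣n

  ZEnd⇒den≡0 : ∀ {n} .{{_ : ℕ.NonZero n}} k (y : Pair n) → ZEnd k y → toℕ (proj₂ y) ≡ 0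
  ZEnd⇒den≡0 k (_ , d) (_ , d≡0) = toℕ≈0⇒≡0 d (≡mod⇒≈ d≡0)

  module _ (t : ℕ) where
    private
      instance
        p^[1+t]≢0 : ℕ.NonZero (p ^ suc t)
        p^[1+t]≢0 = ℕP.m^n≢0 p (suc t)

    ZtEnd-lift⇔ : ∀ k (s s′ : Fin p) (y : Pair (p ^ suc t)) →
                  ZtEnd k (suc t) (lift s s′ y) ⇔ (ZEnd k y × toℕ s′ ≢ 0)
    ZtEnd-lift⇔ k s s′ y@(c , d) = mk⇔ to from
      where
      N = p ^ suc t
      p∣N = ℕ∣.m∣m*n (p ^ t)
      b = toℕ (combine s′ d)
      num-lift≈ : num (lift s s′ y) ≈ num y [mod N ]
      num-lift≈ = proj₁ (lift-≈ᴾ s s′ y)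
      b≡Ns′ : toℕ d ≡ 0 → b ≡ N * toℕ s′
      b≡Ns′ d≡0 = trans (FinP.toℕ-combine s′ d) (trans (cong (N * toℕ s′ ℕ.+_) d≡0) (ℕP.+-identityʳ _))

      to : ZtEnd k (suc t) (lift s s′ y) → ZEnd k y × toℕ s′ ≢ 0
      to (_ , _ , N∣b , pN∤b , a≡ε) =
        (≡mod-resp-≈ {c = ε k} ℕ∣.∣-refl num-lift≈ a≡ε , ≈⇒≡mod (≈-reflexive (cong +_ d≡0))) , s′≢0
        where
        d≡0 : toℕ d ≡ 0
        d≡0 = ∣∧<⇒≡0 (ℕ∣.∣m+n∣m⇒∣n (subst (N ℕ∣.∣_) (FinP.toℕ-combine s′ d) N∣b) (ℕ∣.m∣m*n (toℕ s′))) (FinP.toℕ<n d)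
        s′≢0 : toℕ s′ ≢ 0
        s′≢0 s′≡0 = pN∤b (subst (p * N ℕ∣.∣_) (sym (trans (b≡Ns′ d≡0) (trans (cong (N *_) s′≡0) (ℕP.*-zeroʳ N))))
                                (ℕ∣._∣0 (p * N)))

      from : ZEnd k y × toℕ s′ ≢ 0 → ZtEnd k (suc t) (lift s s′ y)
      from ((c≡ε , d≡0[N]) , s′≢0) =
        ≈⇒≡mod (≈-weaken p∣N (≡mod⇒≈ {x = num (lift s s′ y)} {y = ε k} a≡ε)) , ≈⇒≡mod (∣⇒≈0 p∣b) , N∣b , pN∤b , a≡ε
        where
        d≡0 = toℕ≈0⇒≡0 d (≡mod⇒≈ d≡0[N])
        a≡ε : num (lift s s′ y) ≡ ε k [mod N ]
        a≡ε = ≡mod-resp-≈ {c = ε k} ℕ∣.∣-refl (≈-sym num-lift≈) c≡ε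
        N∣b : N ℕ∣.∣ b
        N∣b = subst (N ℕ∣.∣_) (sym (b≡Ns′ d≡0)) (ℕ∣.m∣m*n (toℕ s′))
        p∣b : p ℕ∣.∣ b
        p∣b = ℕ∣.∣-trans p∣N N∣b
        pN∤b : ¬ p * N ℕ∣.∣ b
        pN∤b pN∣b =
          s′≢0 (∣∧<⇒≡0 (ℕ∣.*-cancelˡ-∣ N (subst₂ ℕ∣._∣_ (ℕP.*-comm p N) (b≡Ns′ d≡0) pN∣b)) (FinP.toℕ<n s′))

  module _ (k r : ℕ) where
    private
      instance
        p^[1+r]≢0 : ℕ.NonZero (p ^ suc r)
        p^[1+r]≢0 = ℕP.m^n≢0 p (suc r)

      n = 2 * suc k
      N = p ^ suc r
      1<pN = 1<p^[1+n] (suc r)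
      1<N = 1<p^[1+n] r
      p∣N : p ℕ∣.∣ N
      p∣N = ℕ∣.m∣m*n (p ^ r)

      open WalkLifting {p} {N} p-prime p∣N

      Ω-compat : ∀ j (x : Pair (p * N)) → ΩCondition j x ⇔ ΩCondition j (reducePair N x)
      Ω-compat j x = mk⇔ (ΩCondition-≈ᴾ {j} (≈ᴾ-weaken p∣N (≈ᴾ-sym (reducePair-≈ᴾ N x))))
                         (ΩCondition-≈ᴾ {j} (≈ᴾ-weaken p∣N (reducePair-≈ᴾ N x)))

    ∣Zt∣-lift : ∀ t → t ℕ.< suc r → ∣Zt∣ p (suc k) (suc (suc r)) t ≡ p ^ n * ∣Zt∣ p (suc k) (suc r) t
    ∣Zt∣-lift t t<1+r = begin
      ∣Zt∣ p (suc k) (suc (suc r)) t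
        ≡⟨ M.count (inZt? p (suc k) (suc (suc r)) t) ⟩
      M.walks ΩCondition? n (1/0 1<pN)
        ≡⟨ walks-lift₀ (ZtEnd? (suc k) t) (ZtEnd? (suc k) t) ZtEnd-compat n ΩCondition? ΩCondition? Ω-compat (1/0 1<pN) ⟩
      p ^ n * N.walks ΩCondition? n (reducePair N (1/0 1<pN))
        ≡⟨ cong (λ x → p ^ n * N.walks ΩCondition? n x) (reducePair-1/0 1<pN 1<N) ⟩
      p ^ n * N.walks ΩCondition? n (1/0 1<N)
        ≡⟨ cong (p ^ n *_) (N.count (inZt? p (suc k) (suc r) t)) ⟨
      p ^ n * ∣Zt∣ p (suc k) (suc r) t ∎
      where
      open ≡-Reasoning
      module M = Counting k (suc r) (ZtEnd? (suc k) t)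
      module N = Counting k r (ZtEnd? (suc k) t)
      p^[1+t]∣N = ^-monoʳ-∣ p t<1+r
      ZtEnd-compat : ∀ x → ZtEnd (suc k) t x ⇔ ZtEnd (suc k) t (reducePair N x)
      ZtEnd-compat x = mk⇔ (ZtEnd-≈ᴾ {suc k} {t} p^[1+t]∣N (≈ᴾ-sym (reducePair-≈ᴾ N x)))
                           (ZtEnd-≈ᴾ {suc k} {t} p^[1+t]∣N (reducePair-≈ᴾ N x))

    ∣Zt∣-top : ∣Zt∣ p (suc k) (suc (suc r)) (suc r) ≡ p ^ (n ∸ 1) * (p ∸ 1) * ∣Z∣ p (suc k) (suc r)
    ∣Zt∣-top = begin
      ∣Zt∣ p (suc k) (suc (suc r)) (suc r)
        ≡⟨ M.count (inZt? p (suc k) (suc (suc r)) (suc r)) ⟩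
      M.walks ΩCondition? (suc (n ∸ 1)) (1/0 1<pN)
        ≡⟨ walks-lift₁ (ZtEnd? (suc k) (suc r)) (ZEnd? (suc k)) (λ s s′ y → ZtEnd-lift⇔ r (suc k) s s′ y)
                       (ZEnd⇒den≡0 (suc k)) (n ∸ 1) ΩCondition? ΩCondition? Ω-compat (1/0 1<pN) ⟩
      p ^ (n ∸ 1) * (p ∸ 1) * N.walks ΩCondition? n (reducePair N (1/0 1<pN))
        ≡⟨ cong (λ x → p ^ (n ∸ 1) * (p ∸ 1) * N.walks ΩCondition? n x) (reducePair-1/0 1<pN 1<N) ⟩
      p ^ (n ∸ 1) * (p ∸ 1) * N.walks ΩCondition? n (1/0 1<N)
        ≡⟨ cong (p ^ (n ∸ 1) * (p ∸ 1) *_) (N.count (inZ? p (suc k) (suc r))) ⟨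
      p ^ (n ∸ 1) * (p ∸ 1) * ∣Z∣ p (suc k) (suc r) ∎
      where
      open ≡-Reasoning
      module M = Counting k (suc r) (ZtEnd? (suc k) (suc r))
      module N = Counting k r (ZEnd? (suc k))

open import Data.Nat using (_*_; _∸_; _^_; _≤_; _<_)

lemma9 : (p : ℕ) → Prime p → (k : ℕ) → 1 ≤ k → (r : ℕ) → 1 < r →
    ((t : ℕ) → 1 ≤ t → t < r ∸ 1 → ∣Zt∣ p k r t ≡ p ^ (2 * k) * ∣Zt∣ p k (r ∸ 1) t)
    × (∣Zt∣ p k r (r ∸ 1) ≡ p ^ (2 * k ∸ 1) * (p ∸ 1) * ∣Z∣ p k (r ∸ 1))
lemma9 p p-prime (suc k) _ (suc (suc r)) (ℕ.s≤s (ℕ.s≤s ℕ.z≤n)) = (λ t _ → ∣Zt∣-lift k r t) , ∣Zt∣-top k r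
  where open ΩLifts p-prime
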